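{- For every fixed $k\in\mathbb{N}$, $DM(n,n-k)=O(n^k)$ as $n\to\infty$.
   Context: A distance monoid is a structure $(R,\oplus,\leq,0)$ such that: $\leq$ is a total order on $R$; $r\leq r\oplus s$ for all $r,s$; if $r\leq t$ and $s\leq u$ then $r\oplus s\leq t\oplus u$; $\oplus$ is commutative and associative; and $r\oplus 0=r$ for all $r$. The Archimedean complexity $\mathrm{arch}(R)$ of a distance monoid $R$ is the least $m$ such that for all $r_0\leq r_1\leq\cdots\leq r_m$ in $R$ one has $r_0\oplus r_1\oplus\cdots\oplus r_m=r_1\oplus\cdots\oplus r_m$ (and $\omega$ if no such $m$ exists). $DM(n,k)$ denotes the number of distance monoids (up to isomorphism of ordered monoids) with exactly $n$ non-zero elements and Archimedean complexity $k$. -}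

module Defs where

open import Data.Nat using (ℕ; zero; suc; _<_)
open import Data.Fin using (Fin; zero; suc; inject₁)
open import Data.Product using (_×_)
open import Relation.Binary.PropositionalEquality using (_≡_)
open import Relation.Binary.Structures using (IsTotalOrder)
open import Relation.Nullary using (¬_)
open import Function.Bundles using (_↔_)

record DistanceMonoid : Set₁ where
  infixl 6 _⊕_
  infix 4 _≤_
  field
    Carrier      : Set
    _⊕_          : Carrier → Carrier → Carrier
    _≤_          : Carrier → Carrier → Set
    𝟘            : Carrier
    isTotalOrder : IsTotalOrder _≡_ _≤_
    ≤-⊕          : ∀ r s → r ≤ r ⊕ s
    ⊕-mono       : ∀ {r s t u} → r ≤ t → s ≤ u → r ⊕ s ≤ t ⊕ u
    ⊕-comm       : ∀ r s → r ⊕ s ≡ s ⊕ r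
    ⊕-assoc      : ∀ r s t → (r ⊕ s) ⊕ t ≡ r ⊕ (s ⊕ t)
    ⊕-identityʳ  : ∀ r → r ⊕ 𝟘 ≡ r

module _ (R : DistanceMonoid) where
  open DistanceMonoid R

  bigSum : ∀ {m} → (Fin m → Carrier) → Carrier
  bigSum {zero}  r = 𝟘
  bigSum {suc m} r = r zero ⊕ bigSum (λ i → r (suc i))

  Ascending : ∀ {m} → (Fin (suc m) → Carrier) → Set
  Ascending {m} r = ∀ (i : Fin m) → r (inject₁ i) ≤ r (suc i)

  ArchProperty : ℕ → Set
  ArchProperty m = ∀ (r : Fin (suc m) → Carrier) → Ascending r →
                   bigSum r ≡ bigSum (λ i → r (suc i))

  HasArch : ℕ → Set
  HasArch k = ArchProperty k × (∀ m → m < k → ¬ ArchProperty m)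

  -- R has exactly n non-zero elements, i.e. exactly n+1 elements
  HasNonZeroCount : ℕ → Set
  HasNonZeroCount n = Carrier ↔ Fin (suc n)

record _≅_ (R S : DistanceMonoid) : Set where
  private
    module R = DistanceMonoid R
    module S = DistanceMonoid S
  field
    to        : R.Carrier → S.Carrier
    from      : S.Carrier → R.Carrier
    from∘to   : ∀ x → from (to x) ≡ x
    to∘from   : ∀ y → to (from y) ≡ y
    to-⊕      : ∀ x y → to (x R.⊕ y) ≡ to x S.⊕ to y
    to-𝟘      : to R.𝟘 ≡ S.𝟘
    to-mono   : ∀ {x y} → x R.≤ y → to x S.≤ to y
    to-reflect : ∀ {x y} → to x S.≤ to y → x R.≤ y

-- Let R have n + 1 elements and arch(R) = L = n ∸ k with n ≥ 2k + 2. Some d has strictly increasing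
-- multiples 0 · d < d < ⋯ < L · d with (L + 1) · d = L · d: otherwise a sum witnessing arch(R) > L - 1,
-- read backwards, exhibits 2L > n + 1 distinct elements. Each of the remaining k elements (gaps)
-- lies strictly between I · d and (I + 1) · d for some level I, so g ⊕ d and g ⊕ g′ are gaps or
-- multiples of d within two steps of a known index. Hence R is determined up to isomorphism by a
-- code: the levels of the gaps and k + k² descriptors with k + 3 values each. There are
-- (L + 1)^k (k + 3)^(k + k²) = O(n^k) codes, and keeping those whose model is a distance monoid of
-- Archimedean complexity L gives the required list.

module Submission where

open import Defs
open import Data.Nat as ℕ using (ℕ; zero; suc; _+_; _*_; _∸_; _^_; _⊓_; z≤n; s≤s)
import Data.Nat.Properties as ℕₚ
open import Data.Nat.GeneralisedArithmetic using (iterate)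
open import Data.Fin as Fin using (Fin; toℕ; fromℕ<; inject₁)
import Data.Fin.Properties as Finₚ
open import Data.Product using (Σ; ∃; _×_; _,_; proj₁; proj₂)
open import Data.Sum using (_⊎_; inj₁; inj₂)
open import Data.Sum.Properties using (inj₂-injective)
open import Data.Empty using (⊥-elim)
open import Data.Maybe using (Maybe; just; nothing)
import Data.Maybe.Relation.Unary.All as MaybeAll
import Data.Maybe.Relation.Unary.Any as MaybeAny
open import Data.List using (List; length; mapMaybe; allFin)
import Data.List.Properties as Listₚ
open import Data.List.Relation.Unary.All as All using (All)
import Data.List.Relation.Unary.All.Properties as Allₚ
open import Data.List.Relation.Unary.Any using (Any)
import Data.List.Relation.Unary.Any.Properties as Anyₚ
open import Data.List.Membership.Propositional using (lose)
open import Data.List.Membership.Propositional.Properties using (∈-allFin)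
open import Data.Sum.Function.Propositional using (_⊎-↔_)
open import Function using (_∘_; const; id; _↣_; _↔_; Inverse; Injection; mk↣)
open import Function.Construct.Composition using (_↣-∘_)
open import Function.Properties.Inverse using (↔-refl; ↔-sym; ↔-trans; ↔⇒↣)
open import Relation.Nullary using (¬_; Dec; yes; no; ¬?)
open import Relation.Nullary.Decidable using (via-injection; map′; _×-dec_; _→-dec_)
open import Relation.Binary.Bundles using (TotalOrder)
open import Relation.Binary.Structures using (IsTotalOrder)
open import Relation.Binary.Definitions using (DecidableEquality; Decidable; tri<; tri≈; tri>)
open import Relation.Binary.PropositionalEquality
import Relation.Binary.Construct.NonStrictToStrict as ToStrict
import Relation.Binary.Properties.TotalOrder as TotalOrderProperties
open import Relation.Binary.Bundles using (DecTotalOrder)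
open import Data.Vec.Functional using ([]; _∷_)
import Relation.Binary.Reasoning.PartialOrder as PartialOrderReasoning
import Algebra.Properties.CommutativeSemigroup as CommutativeSemigroupProperties

module DistanceMonoidProperties (M : DistanceMonoid) where
  open DistanceMonoid M public

  open IsTotalOrder isTotalOrder public
    using (total; antisym)
    renaming (refl to ≤-refl; trans to ≤-trans; reflexive to ≤-reflexive)

  totalOrder : TotalOrder _ _ _
  totalOrder = record { isTotalOrder = isTotalOrder }

  open TotalOrderProperties totalOrder public
    using (_<_; <-trans; <-irrefl; <⇒≱; <⇒≉)

  module ≤-Reasoning = PartialOrderReasoning (TotalOrder.poset totalOrder)

  <⇒≤ : ∀ {x y} → x < y → x ≤ y
  <⇒≤ = proj₁

  <-≤-trans : ∀ {x y z} → x < y → y ≤ z → x < z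
  <-≤-trans = ToStrict.<-≤-trans _≡_ _≤_ sym ≤-trans antisym (λ eq → subst (_ ≤_) eq)

  𝟘-least : ∀ x → 𝟘 ≤ x
  𝟘-least x = subst (𝟘 ≤_) (trans (⊕-comm 𝟘 x) (⊕-identityʳ x)) (≤-⊕ 𝟘 x)

  ≤-⊕ˡ : ∀ x y → y ≤ x ⊕ y
  ≤-⊕ˡ x y = subst (y ≤_) (⊕-comm y x) (≤-⊕ y x)

  ⊕-monoˡ-≤ : ∀ {x y} z → x ≤ y → x ⊕ z ≤ y ⊕ z
  ⊕-monoˡ-≤ z x≤y = ⊕-mono x≤y ≤-refl

  ⊕-monoʳ-≤ : ∀ {x y} z → x ≤ y → z ⊕ x ≤ z ⊕ y
  ⊕-monoʳ-≤ z x≤y = ⊕-mono ≤-refl x≤y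

  ⊕-swapʳ : ∀ x y z → (x ⊕ y) ⊕ z ≡ (x ⊕ z) ⊕ y
  ⊕-swapʳ x y z = begin
    (x ⊕ y) ⊕ z ≡⟨ ⊕-assoc x y z ⟩
    x ⊕ (y ⊕ z) ≡⟨ cong (x ⊕_) (⊕-comm y z) ⟩
    x ⊕ (z ⊕ y) ≡⟨ ⊕-assoc x z y ⟨
    (x ⊕ z) ⊕ y ∎
    where open ≡-Reasoning

  Absorbs : Carrier → Carrier → Set
  Absorbs x d = x ⊕ d ≡ x

  absorbs-⊕ : ∀ {x d} y → Absorbs x d → Absorbs (x ⊕ y) d
  absorbs-⊕ {x} {d} y x⊕d≡x = trans (⊕-swapʳ x y d) (cong (_⊕ y) x⊕d≡x)

  bigSum-cong : ∀ {m} {f g : Fin m → Carrier} → f ≗ g → bigSum M f ≡ bigSum M g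
  bigSum-cong {zero}  f≗g = refl
  bigSum-cong {suc m} f≗g = cong₂ _⊕_ (f≗g Fin.zero) (bigSum-cong (f≗g ∘ Fin.suc))

  ∑ : (ℕ → Carrier) → ℕ → Carrier
  ∑ e zero    = 𝟘
  ∑ e (suc i) = ∑ e i ⊕ e i

  infixr 7 _·_
  _·_ : ℕ → Carrier → Carrier
  i · d = ∑ (const d) i

  ∑-cong : ∀ {e e′} m → (∀ i → i ℕ.< m → e i ≡ e′ i) → ∑ e m ≡ ∑ e′ m
  ∑-cong zero    _  = refl
  ∑-cong (suc m) eq = cong₂ _⊕_ (∑-cong m (λ i i<m → eq i (ℕₚ.m<n⇒m<1+n i<m))) (eq m ℕₚ.≤-refl)

  ∑-+ : ∀ e i o → ∑ e (i + o) ≡ ∑ e i ⊕ ∑ (λ t → e (i + t)) o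
  ∑-+ e i zero    = trans (cong (∑ e) (ℕₚ.+-identityʳ i)) (sym (⊕-identityʳ _))
  ∑-+ e i (suc o) = begin
    ∑ e (i + suc o)                                ≡⟨ cong (∑ e) (ℕₚ.+-suc i o) ⟩
    ∑ e (i + o) ⊕ e (i + o)                        ≡⟨ cong (_⊕ e (i + o)) (∑-+ e i o) ⟩
    (∑ e i ⊕ ∑ (λ t → e (i + t)) o) ⊕ e (i + o)    ≡⟨ ⊕-assoc _ _ _ ⟩
    ∑ e i ⊕ ∑ (λ t → e (i + t)) (suc o)            ∎
    where open ≡-Reasoning

  ∑-mono-≤ : ∀ e {i j} → i ℕ.≤ j → ∑ e i ≤ ∑ e j
  ∑-mono-≤ e {i} {j} i≤j with o , refl ← ℕₚ.m≤n⇒∃[o]m+o≡n i≤j =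
    subst (∑ e i ≤_) (sym (∑-+ e i o)) (≤-⊕ (∑ e i) _)

  ∑-mono-pointwise : ∀ {a b} m → (∀ t → t ℕ.< m → a t ≤ b t) → ∑ a m ≤ ∑ b m
  ∑-mono-pointwise zero    _   = ≤-refl
  ∑-mono-pointwise (suc m) a≤b =
    ⊕-mono (∑-mono-pointwise m (λ t t<m → a≤b t (ℕₚ.m<n⇒m<1+n t<m))) (a≤b m ℕₚ.≤-refl)

  ·-distribʳ-+ : ∀ d i j → (i + j) · d ≡ i · d ⊕ j · d
  ·-distribʳ-+ d = ∑-+ (const d)

  absorbs-· : ∀ {x d} → Absorbs x d → ∀ t → Absorbs x (t · d)
  absorbs-· {x} x⊕d≡x zero    = ⊕-identityʳ x
  absorbs-· {x} {d} x⊕d≡x (suc t) = begin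
    x ⊕ (t · d ⊕ d) ≡⟨ ⊕-assoc x _ d ⟨
    (x ⊕ t · d) ⊕ d ≡⟨ cong (_⊕ d) (absorbs-· x⊕d≡x t) ⟩
    x ⊕ d           ≡⟨ x⊕d≡x ⟩
    x               ∎
    where open ≡-Reasoning

  ·-absorbs : ∀ {d} L → Absorbs (L · d) d → ∀ m → L ℕ.≤ m → m · d ≡ L · d
  ·-absorbs {d} L absorbs m L≤m with o , refl ← ℕₚ.m≤n⇒∃[o]m+o≡n L≤m =
    trans (·-distribʳ-+ d L o) (absorbs-· absorbs o)

  ∑-absorbs-mono : ∀ e {d i j} → i ℕ.≤ j → Absorbs (∑ e i) d → Absorbs (∑ e j) d
  ∑-absorbs-mono e {d} {i} i≤j absorbs with o , refl ← ℕₚ.m≤n⇒∃[o]m+o≡n i≤j =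
    subst (λ x → Absorbs x d) (sym (∑-+ e i o)) (absorbs-⊕ _ absorbs)

  StrictlyIncreasingUpTo : ℕ → (ℕ → Carrier) → Set
  StrictlyIncreasingUpTo B f = ∀ q → q ℕ.< B → f q < f (suc q)

  module _ {B f} (increasing : StrictlyIncreasingUpTo B f) where

    strictlyIncreasing-< : ∀ {i j} → i ℕ.< j → j ℕ.≤ B → f i < f j
    strictlyIncreasing-< {i} {suc j} (s≤s i≤j) 1+j≤B with ℕₚ.m≤n⇒m<n∨m≡n i≤j
    ... | inj₂ refl = increasing i 1+j≤B
    ... | inj₁ i<j  = <-trans (strictlyIncreasing-< i<j (ℕₚ.<⇒≤ 1+j≤B)) (increasing j 1+j≤B)

    strictlyIncreasing-reflects-≤ : ∀ {i j} → i ℕ.≤ B → f i ≤ f j → i ℕ.≤ j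
    strictlyIncreasing-reflects-≤ i≤B fi≤fj =
      ℕₚ.≮⇒≥ (λ j<i → <⇒≱ (strictlyIncreasing-< j<i i≤B) fi≤fj)

    strictlyIncreasing-reflects-< : ∀ {i j} → i ℕ.≤ B → j ℕ.≤ B → f i < f j → i ℕ.< j
    strictlyIncreasing-reflects-< i≤B j≤B (fi≤fj , fi≢fj) =
      ℕₚ.≤∧≢⇒< (strictlyIncreasing-reflects-≤ i≤B fi≤fj) (λ { refl → fi≢fj refl })

    strictlyIncreasing-injective : ∀ {i j} → i ℕ.≤ B → j ℕ.≤ B → f i ≡ f j → i ≡ j
    strictlyIncreasing-injective i≤B j≤B fi≡fj = ℕₚ.≤-antisym
      (strictlyIncreasing-reflects-≤ i≤B (≤-reflexive fi≡fj))
      (strictlyIncreasing-reflects-≤ j≤B (≤-reflexive (sym fi≡fj)))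

  NonIncreasing : (ℕ → Carrier) → Set
  NonIncreasing e = ∀ i → e (suc i) ≤ e i

  module _ {e} (nonIncreasing : NonIncreasing e) where

    nonIncreasing-antitone : ∀ {i j} → i ℕ.≤ j → e j ≤ e i
    nonIncreasing-antitone {i} {j} i≤j with ℕₚ.m≤n⇒m<n∨m≡n i≤j
    ... | inj₂ refl = ≤-refl
    ... | inj₁ i<j with suc j′ ← j = ≤-trans (nonIncreasing j′) (nonIncreasing-antitone (ℕ.s≤s⁻¹ i<j))

    ∑-stall-suc : ∀ i → ∑ e (suc i) ≡ ∑ e i → ∑ e (suc (suc i)) ≡ ∑ e (suc i)
    ∑-stall-suc i stall = antisym ∑₂≤∑₁ (≤-⊕ _ _)
      where
      open ≤-Reasoning
      ∑₂≤∑₁ : ∑ e (suc i) ⊕ e (suc i) ≤ ∑ e (suc i)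
      ∑₂≤∑₁ = begin
        ∑ e (suc i) ⊕ e (suc i) ≤⟨ ⊕-monoʳ-≤ _ (nonIncreasing i) ⟩
        ∑ e (suc i) ⊕ e i       ≡⟨ cong (_⊕ e i) stall ⟩
        ∑ e (suc i)             ∎

    ∑-stall-persists : ∀ {i j} → i ℕ.≤ j → ∑ e (suc i) ≡ ∑ e i → ∑ e (suc j) ≡ ∑ e j
    ∑-stall-persists {i} {j} i≤j stall with ℕₚ.m≤n⇒m<n∨m≡n i≤j
    ... | inj₂ refl = stall
    ... | inj₁ i<j with suc j′ ← j = ∑-stall-suc j′ (∑-stall-persists (ℕ.s≤s⁻¹ i<j) stall)

    ∑-strictlyIncreasing : ∀ L → ∑ e (suc L) ≢ ∑ e L → StrictlyIncreasingUpTo (suc L) (∑ e)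
    ∑-strictlyIncreasing L last-strict q q<1+L =
      ≤-⊕ _ _ , λ stall → last-strict (∑-stall-persists (ℕ.s≤s⁻¹ q<1+L) (sym stall))

  record PowerChain (L : ℕ) : Set where
    field
      generator  : Carrier
      increasing : StrictlyIncreasingUpTo L (_· generator)
      saturated  : Absorbs (L · generator) generator

module LongSums (M : DistanceMonoid) (_≟_ : DecidableEquality (DistanceMonoid.Carrier M)) where
  open DistanceMonoidProperties M

  remove : ℕ → (ℕ → Carrier) → ℕ → Carrier
  remove i e j with j ℕ.<? i
  ... | yes _ = e j
  ... | no  _ = e (suc j)

  remove-< : ∀ {i} e {j} → j ℕ.< i → remove i e j ≡ e j
  remove-< {i} e {j} j<i with j ℕ.<? i
  ... | yes _   = refl
  ... | no  j≮i = ⊥-elim (j≮i j<i)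

  remove-≥ : ∀ {i} e {j} → i ℕ.≤ j → remove i e j ≡ e (suc j)
  remove-≥ {i} e {j} i≤j with j ℕ.<? i
  ... | yes j<i = ⊥-elim (ℕₚ.<⇒≱ j<i i≤j)
  ... | no  _   = refl

  remove-nonIncreasing : ∀ i {e} → NonIncreasing e → NonIncreasing (remove i e)
  remove-nonIncreasing i {e} nonIncreasing j with ℕₚ.<-cmp (suc j) i
  ... | tri< 1+j<i _ _ = subst₂ _≤_ (sym (remove-< e 1+j<i)) (sym (remove-< e (ℕₚ.<-trans (ℕₚ.n<1+n j) 1+j<i)))
                           (nonIncreasing j)
  ... | tri≈ _ refl _ = subst₂ _≤_ (sym (remove-≥ e ℕₚ.≤-refl)) (sym (remove-< e ℕₚ.≤-refl))
                          (≤-trans (nonIncreasing (suc j)) (nonIncreasing j))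
  ... | tri> _ _ i<1+j = subst₂ _≤_ (sym (remove-≥ e (ℕₚ.<⇒≤ i<1+j))) (sym (remove-≥ e (ℕ.s≤s⁻¹ i<1+j)))
                           (nonIncreasing (suc j))

  remove-eventually : ∀ {i H e d} → i ℕ.≤ H → (∀ j → suc H ℕ.≤ j → e j ≡ d) →
                      ∀ j → H ℕ.≤ j → remove i e j ≡ d
  remove-eventually {e = e} i≤H eventually-d j H≤j =
    trans (remove-≥ e (ℕₚ.≤-trans i≤H H≤j)) (eventually-d (suc j) (s≤s H≤j))

  ∑-remove : ∀ i e o → ∑ (remove i e) (i + o) ≡ ∑ e i ⊕ ∑ (λ t → e (suc (i + t))) o
  ∑-remove i e o = trans (∑-+ (remove i e) i o) (cong₂ _⊕_
    (∑-cong i (λ t t<i → remove-< e t<i))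
    (∑-cong o (λ t _ → remove-≥ e (ℕₚ.m≤m+n i t))))

  ∑-remove-redundant : ∀ {i h e d} → ∑ e i ⊕ d ≡ ∑ e (suc i) → (∀ j → h ℕ.≤ j → e j ≡ d) →
                       i ℕ.< h → ∀ j → h ℕ.≤ j → ∑ (remove i e) j ≡ ∑ e j
  ∑-remove-redundant {i} {h} {e} {d} redundant eventually-d i<h j h≤j
    with o , refl ← ℕₚ.m≤n⇒∃[o]m+o≡n (ℕₚ.<-≤-trans i<h h≤j) = begin
      ∑ (remove i e) (suc i + o)                    ≡⟨ cong (∑ (remove i e)) (sym (ℕₚ.+-suc i o)) ⟩
      ∑ (remove i e) (i + suc o)                    ≡⟨ ∑-remove i e (suc o) ⟩
      ∑ e i ⊕ (rest o ⊕ e (suc i + o))              ≡⟨ cong (λ x → ∑ e i ⊕ (rest o ⊕ x)) (eventually-d _ h≤j) ⟩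
      ∑ e i ⊕ (rest o ⊕ d)                          ≡⟨ ⊕-assoc _ _ _ ⟨
      (∑ e i ⊕ rest o) ⊕ d                          ≡⟨ ⊕-swapʳ _ _ _ ⟩
      (∑ e i ⊕ d) ⊕ rest o                          ≡⟨ cong (_⊕ rest o) redundant ⟩
      ∑ e (suc i) ⊕ rest o                          ≡⟨ ∑-+ e (suc i) o ⟨
      ∑ e (suc i + o)                               ∎
    where
    open ≡-Reasoning
    rest : ℕ → Carrier
    rest = ∑ (λ t → e (suc (i + t)))

  -- With u = ∑ e and c = L′ ∸ H, the 2L′ + 2 distinct elements are u 0 < ⋯ < u (L′ + 1), the
  -- u i ⊕ d (i < H), each strictly between u i and u (i + 1), and the u H ⊕ m · d (1 ≤ m ≤ c).
  -- The latter cannot equal any u j: they absorb d from m = c on, while u keeps growing.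
  module StallCase (L′ H : ℕ) {e d} (nonIncreasing : NonIncreasing e)
                   (eventually-d : ∀ i → suc H ℕ.≤ i → e i ≡ d) (1+H≤L′ : suc H ℕ.≤ L′)
                   (last-strict : ∑ e (suc L′) ≢ ∑ e L′)
                   (irredundant : ∀ i → i ℕ.< H → ∑ e i ⊕ d ≢ ∑ e (suc i))
                   (stall : ∑ (remove H e) (suc L′) ≡ ∑ (remove H e) L′) where

    u : ℕ → Carrier
    u = ∑ e

    u-increasing : StrictlyIncreasingUpTo (suc L′) u
    u-increasing = ∑-strictlyIncreasing nonIncreasing L′ last-strict

    u-mono : ∀ {i j} → i ℕ.≤ j → u i ≤ u j
    u-mono = ∑-mono-≤ e

    d≤e : ∀ i → d ≤ e i
    d≤e i = subst (_≤ e i) (eventually-d (suc H + i) (ℕₚ.m≤m+n (suc H) i))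
                  (nonIncreasing-antitone nonIncreasing (ℕₚ.m≤n+m i (suc H)))

    u-shift : ∀ {j} t → suc H ℕ.≤ j → u (j + t) ≡ u j ⊕ t · d
    u-shift {j} t 1+H≤j = trans (∑-+ e j t) (cong (u j ⊕_)
      (∑-cong t (λ s _ → eventually-d (j + s) (ℕₚ.≤-trans 1+H≤j (ℕₚ.m≤m+n j s)))))

    c : ℕ
    c = L′ ∸ H

    H+c≡L′ : H + c ≡ L′
    H+c≡L′ = ℕₚ.m+[n∸m]≡n (ℕₚ.<⇒≤ 1+H≤L′)

    o : ℕ → Carrier
    o m = u H ⊕ m · d

    o-suc : ∀ m → o m ⊕ d ≡ o (suc m)
    o-suc m = ⊕-assoc (u H) (m · d) d

    o-+ : ∀ m t → o (m + t) ≡ o m ⊕ t · d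
    o-+ m t = trans (cong (u H ⊕_) (·-distribʳ-+ d m t)) (sym (⊕-assoc _ _ _))

    ∑-remove-H : ∀ m → ∑ (remove H e) (H + m) ≡ o m
    ∑-remove-H m = trans (∑-remove H e m) (cong (u H ⊕_)
      (∑-cong m (λ t _ → eventually-d (suc (H + t)) (s≤s (ℕₚ.m≤m+n H t)))))

    o-absorbs : Absorbs (o c) d
    o-absorbs = begin
      o c ⊕ d                   ≡⟨ o-suc c ⟩
      o (suc c)                 ≡⟨ ∑-remove-H (suc c) ⟨
      ∑ (remove H e) (H + suc c) ≡⟨ cong (∑ (remove H e)) (trans (ℕₚ.+-suc H c) (cong suc H+c≡L′)) ⟩
      ∑ (remove H e) (suc L′)   ≡⟨ stall ⟩
      ∑ (remove H e) L′         ≡⟨ cong (∑ (remove H e)) H+c≡L′ ⟨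
      ∑ (remove H e) (H + c)    ≡⟨ ∑-remove-H c ⟩
      o c                       ∎
      where open ≡-Reasoning

    o⊕e[H]≡u : ∀ q → o q ⊕ e H ≡ u (suc H + q)
    o⊕e[H]≡u q = trans (⊕-swapʳ (u H) (q · d) (e H)) (sym (u-shift q ℕₚ.≤-refl))

    o-increasing : StrictlyIncreasingUpTo c o
    o-increasing q q<c = subst (o q ≤_) (o-suc q) (≤-⊕ _ _) , λ oq≡o[1+q] →
      proj₂ (u-increasing (suc H + q) (s≤s index≤L′)) (sym (stall-at (trans (o-suc q) (sym oq≡o[1+q]))))
      where
      index≤L′ : suc H + q ℕ.≤ L′
      index≤L′ = subst (suc H + q ℕ.≤_) H+c≡L′ (ℕₚ.+-monoʳ-< H q<c)
      stall-at : Absorbs (o q) d → u (suc (suc H + q)) ≡ u (suc H + q)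
      stall-at absorbs = trans (cong (u (suc H + q) ⊕_) (eventually-d _ (ℕₚ.m≤m+n (suc H) q)))
        (subst (λ x → Absorbs x d) (o⊕e[H]≡u q) (absorbs-⊕ (e H) absorbs))

    o≤u : ∀ m → o m ≤ u (H + m)
    o≤u m = subst (o m ≤_) (sym (∑-+ e H m))
      (⊕-monoʳ-≤ (u H) (∑-mono-pointwise m (λ t _ → d≤e (H + t))))

    o₀<o : ∀ {m} → 1 ℕ.≤ m → m ℕ.≤ c → u H < o m
    o₀<o {m} 1≤m m≤c = subst (_< o m) (⊕-identityʳ (u H)) (strictlyIncreasing-< o-increasing 1≤m m≤c)

    o≢u : ∀ {m j} → 1 ℕ.≤ m → m ℕ.≤ c → j ℕ.≤ suc L′ → o m ≢ u j
    o≢u {m} {j} 1≤m m≤c j≤1+L′ om≡uj with ℕₚ.≤-<-connex j H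
    ... | inj₁ j≤H = <⇒≱ (o₀<o 1≤m m≤c) (subst (_≤ u H) (sym om≡uj) (u-mono j≤H))
    ... | inj₂ H<j = proj₂ (u-increasing (j + t) (s≤s j+t≤L′)) (sym u-stalls)
      where
      t : ℕ
      t = c ∸ m
      m+t≡c : m + t ≡ c
      m+t≡c = ℕₚ.m+[n∸m]≡n m≤c
      j≤H+m : j ℕ.≤ H + m
      j≤H+m = strictlyIncreasing-reflects-≤ u-increasing j≤1+L′ (subst (_≤ u (H + m)) om≡uj (o≤u m))
      j+t≤L′ : j + t ℕ.≤ L′
      j+t≤L′ = begin
        j + t       ≤⟨ ℕₚ.+-monoˡ-≤ t j≤H+m ⟩
        H + m + t   ≡⟨ ℕₚ.+-assoc H m t ⟩
        H + (m + t) ≡⟨ cong (H +_) m+t≡c ⟩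
        H + c       ≡⟨ H+c≡L′ ⟩
        L′          ∎
        where open ℕₚ.≤-Reasoning
      shifted : ∀ s → o (m + s) ≡ u (j + s)
      shifted s = trans (o-+ m s) (trans (cong (_⊕ s · d) om≡uj) (sym (u-shift s H<j)))
      u-stalls : u (suc (j + t)) ≡ u (j + t)
      u-stalls = begin
        u (suc (j + t)) ≡⟨ cong u (ℕₚ.+-suc j t) ⟨
        u (j + suc t)   ≡⟨ shifted (suc t) ⟨
        o (m + suc t)   ≡⟨ cong o (trans (ℕₚ.+-suc m t) (cong suc m+t≡c)) ⟩
        o (suc c)       ≡⟨ o-suc c ⟨
        o c ⊕ d         ≡⟨ o-absorbs ⟩
        o c             ≡⟨ cong o m+t≡c ⟨
        o (m + t)       ≡⟨ shifted t ⟩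
        u (j + t)       ∎
        where open ≡-Reasoning

    g : ℕ → Carrier
    g i = u i ⊕ d

    u<g : ∀ {i} → i ℕ.≤ L′ → u i < g i
    u<g {i} i≤L′ = ≤-⊕ _ _ , λ ui≡gi → last-strict
      (trans (cong (u L′ ⊕_) (eventually-d L′ 1+H≤L′)) (∑-absorbs-mono e i≤L′ (sym ui≡gi)))

    g<u : ∀ {i} → i ℕ.< H → g i < u (suc i)
    g<u {i} i<H = ⊕-monoʳ-≤ (u i) (d≤e i) , irredundant i i<H

    <H⇒≤L′ : ∀ {i} → i ℕ.< H → i ℕ.≤ L′
    <H⇒≤L′ i<H = ℕₚ.<⇒≤ (ℕₚ.<-trans i<H 1+H≤L′)

    g≢u : ∀ {i j} → i ℕ.< H → g i ≢ u j
    g≢u {i} {j} i<H gi≡uj with ℕₚ.≤-<-connex j i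
    ... | inj₁ j≤i = <⇒≱ (u<g (<H⇒≤L′ i<H)) (subst (_≤ u i) (sym gi≡uj) (u-mono j≤i))
    ... | inj₂ i<j = <⇒≱ (g<u i<H) (subst (u (suc i) ≤_) (sym gi≡uj) (u-mono i<j))

    g-< : ∀ {i i′} → i ℕ.< i′ → i′ ℕ.< H → g i < g i′
    g-< i<i′ i′<H = <-≤-trans (g<u (ℕₚ.<-trans i<i′ i′<H)) (≤-trans (u-mono i<i′) (<⇒≤ (u<g (<H⇒≤L′ i′<H))))

    g-injective : ∀ {i i′} → i ℕ.< H → i′ ℕ.< H → g i ≡ g i′ → i ≡ i′
    g-injective {i} {i′} i<H i′<H gi≡gi′ with ℕₚ.<-cmp i i′
    ... | tri< i<i′ _ _ = ⊥-elim (<⇒≉ (g-< i<i′ i′<H) gi≡gi′)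
    ... | tri≈ _ i≡i′ _ = i≡i′
    ... | tri> _ _ i′<i = ⊥-elim (<⇒≉ (g-< i′<i i<H) (sym gi≡gi′))

    g<o : ∀ {i m} → i ℕ.< H → 1 ℕ.≤ m → m ℕ.≤ c → g i < o m
    g<o i<H 1≤m m≤c = <-≤-trans (g<u i<H) (≤-trans (u-mono i<H) (<⇒≤ (o₀<o 1≤m m≤c)))

    Index : Set
    Index = Fin (suc (suc L′)) ⊎ (Fin H ⊎ Fin c)

    element : Index → Carrier
    element (inj₁ j)        = u (toℕ j)
    element (inj₂ (inj₁ i)) = g (toℕ i)
    element (inj₂ (inj₂ m)) = o (suc (toℕ m))

    u-index : (j : Fin (suc (suc L′))) → toℕ j ℕ.≤ suc L′
    u-index j = ℕ.s≤s⁻¹ (Finₚ.toℕ<n j)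

    element-injective : ∀ {x y} → element x ≡ element y → x ≡ y
    element-injective {inj₁ j} {inj₁ j′} eq =
      cong inj₁ (Finₚ.toℕ-injective (strictlyIncreasing-injective u-increasing (u-index j) (u-index j′) eq))
    element-injective {inj₁ j} {inj₂ (inj₁ i)} eq = ⊥-elim (g≢u {j = toℕ j} (Finₚ.toℕ<n i) (sym eq))
    element-injective {inj₁ j} {inj₂ (inj₂ m)} eq = ⊥-elim (o≢u (s≤s z≤n) (Finₚ.toℕ<n m) (u-index j) (sym eq))
    element-injective {inj₂ (inj₁ i)} {inj₁ j} eq = ⊥-elim (g≢u {j = toℕ j} (Finₚ.toℕ<n i) eq)
    element-injective {inj₂ (inj₁ i)} {inj₂ (inj₁ i′)} eq =
      cong (inj₂ ∘ inj₁) (Finₚ.toℕ-injective (g-injective (Finₚ.toℕ<n i) (Finₚ.toℕ<n i′) eq))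
    element-injective {inj₂ (inj₁ i)} {inj₂ (inj₂ m)} eq = ⊥-elim (<⇒≉ (g<o (Finₚ.toℕ<n i) (s≤s z≤n) (Finₚ.toℕ<n m)) eq)
    element-injective {inj₂ (inj₂ m)} {inj₁ j} eq = ⊥-elim (o≢u (s≤s z≤n) (Finₚ.toℕ<n m) (u-index j) eq)
    element-injective {inj₂ (inj₂ m)} {inj₂ (inj₁ i)} eq =
      ⊥-elim (<⇒≉ (g<o (Finₚ.toℕ<n i) (s≤s z≤n) (Finₚ.toℕ<n m)) (sym eq))
    element-injective {inj₂ (inj₂ m)} {inj₂ (inj₂ m′)} eq = cong (inj₂ ∘ inj₂) (Finₚ.toℕ-injective
      (ℕₚ.suc-injective (strictlyIncreasing-injective o-increasing (Finₚ.toℕ<n m) (Finₚ.toℕ<n m′) eq)))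

    injection : Fin (suc (suc L′) + L′) ↣ Carrier
    injection = subst (λ t → Fin (suc (suc L′) + t) ↣ Carrier) H+c≡L′
      (mk↣ element-injective ↣-∘ ↔⇒↣ (↔-trans Finₚ.+↔⊎ (↔-refl ⊎-↔ Finₚ.+↔⊎)))

  -- Induction on h, the index from which e is constantly d. A term e i (i < H) that can be
  -- replaced by d without changing the next partial sum is removed, and so is e H if that keeps
  -- the last step strict; otherwise StallCase applies.
  ∑-strict⇒·-strict⊎large : ∀ L′ h {e d} → NonIncreasing e → (∀ i → h ℕ.≤ i → e i ≡ d) → h ℕ.≤ L′ →
                            ∑ e (suc L′) ≢ ∑ e L′ →
                            suc L′ · d ≢ L′ · d ⊎ Fin (suc (suc L′) + L′) ↣ Carrier
  ∑-strict⇒·-strict⊎large L′ zero {e} {d} _ eventually-d _ last-strict = inj₁ λ eq →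
    last-strict (trans (∑-cong (suc L′) (λ i _ → eventually-d i z≤n)) (trans eq (∑-cong L′ (λ i _ → sym (eventually-d i z≤n)))))
  ∑-strict⇒·-strict⊎large L′ (suc H) {e} {d} nonIncreasing eventually-d 1+H≤L′ last-strict
    with ℕₚ.anyUpTo? (λ i → (∑ e i ⊕ d) ≟ ∑ e (suc i)) H
  ... | yes (i , i<H , redundant) =
    ∑-strict⇒·-strict⊎large L′ H (remove-nonIncreasing i nonIncreasing)
      (remove-eventually (ℕₚ.<⇒≤ i<H) eventually-d) (ℕₚ.<⇒≤ 1+H≤L′) last-strict′
    where
    unchanged : ∀ j → suc H ℕ.≤ j → ∑ (remove i e) j ≡ ∑ e j
    unchanged = ∑-remove-redundant redundant eventually-d (ℕₚ.m<n⇒m<1+n i<H)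
    last-strict′ : ∑ (remove i e) (suc L′) ≢ ∑ (remove i e) L′
    last-strict′ eq = last-strict (trans (sym (unchanged (suc L′) (ℕₚ.m≤n⇒m≤1+n 1+H≤L′)))
                                         (trans eq (unchanged L′ 1+H≤L′)))
  ... | no none-redundant with ∑ (remove H e) (suc L′) ≟ ∑ (remove H e) L′
  ...   | no last-strict′ =
    ∑-strict⇒·-strict⊎large L′ H (remove-nonIncreasing H nonIncreasing)
      (remove-eventually ℕₚ.≤-refl eventually-d) (ℕₚ.<⇒≤ 1+H≤L′) last-strict′
  ...   | yes stall = inj₂ (StallCase.injection L′ H nonIncreasing eventually-d 1+H≤L′ last-strict
                              (λ i i<H redundant → none-redundant (i , i<H , redundant)) stall)

module BigSums (M : DistanceMonoid) where
  open DistanceMonoidProperties M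

  bigSum-const : ∀ m d → bigSum M {m} (const d) ≡ m · d
  bigSum-const zero    d = refl
  bigSum-const (suc m) d = trans (cong (d ⊕_) (bigSum-const m d)) (⊕-comm d (m · d))

  reversedIndex : ∀ m → ℕ → Fin (suc m)
  reversedIndex m i = fromℕ< (s≤s (ℕₚ.m∸n≤m m i))

  toℕ-reversedIndex : ∀ m i → toℕ (reversedIndex m i) ≡ m ∸ i
  toℕ-reversedIndex m i = Finₚ.toℕ-fromℕ< (s≤s (ℕₚ.m∸n≤m m i))

  -- r read backwards; as m ∸ i is truncated, the sequence then continues constantly with r 0.
  reversed : ∀ m → (Fin (suc m) → Carrier) → ℕ → Carrier
  reversed m r i = r (reversedIndex m i)

  reversed-≥ : ∀ {m} r {i} → m ℕ.≤ i → reversed m r i ≡ r Fin.zero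
  reversed-≥ {m} r {i} m≤i =
    cong r (Finₚ.toℕ-injective (trans (toℕ-reversedIndex m i) (ℕₚ.m≤n⇒m∸n≡0 m≤i)))

  reversed-suc : ∀ {m} r {i} → i ℕ.≤ m → reversed (suc m) r i ≡ reversed m (r ∘ Fin.suc) i
  reversed-suc {m} r {i} i≤m = cong r (Finₚ.toℕ-injective (begin
    toℕ (reversedIndex (suc m) i)      ≡⟨ toℕ-reversedIndex (suc m) i ⟩
    suc m ∸ i                          ≡⟨ ℕₚ.+-∸-assoc 1 i≤m ⟩
    suc (m ∸ i)                        ≡⟨ cong suc (toℕ-reversedIndex m i) ⟨
    toℕ (Fin.suc (reversedIndex m i))  ∎))
    where open ≡-Reasoning

  ascending-suc : ∀ {m} (r : Fin (suc m) → Carrier) → Ascending M r →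
                  ∀ {a b} → suc (toℕ a) ≡ toℕ b → r a ≤ r b
  ascending-suc r ascending {a} {Fin.suc j} 1+a≡1+j =
    subst (λ x → r x ≤ r (Fin.suc j))
      (Finₚ.toℕ-injective (trans (Finₚ.toℕ-inject₁ j) (sym (ℕₚ.suc-injective 1+a≡1+j))))
      (ascending j)

  reversed-nonIncreasing : ∀ {m} r → Ascending M r → NonIncreasing (reversed m r)
  reversed-nonIncreasing {m} r ascending i with ℕₚ.<-≤-connex i m
  ... | inj₁ i<m = ascending-suc r ascending (begin
    suc (toℕ (reversedIndex m (suc i))) ≡⟨ cong suc (toℕ-reversedIndex m (suc i)) ⟩
    suc (m ∸ suc i)                     ≡⟨ ℕₚ.+-∸-assoc 1 i<m ⟨
    m ∸ i                               ≡⟨ toℕ-reversedIndex m i ⟨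
    toℕ (reversedIndex m i)             ∎)
    where open ≡-Reasoning
  ... | inj₂ m≤i = ≤-reflexive (trans (reversed-≥ r (ℕₚ.m≤n⇒m≤1+n m≤i)) (sym (reversed-≥ r m≤i)))

  bigSum≡∑-reversed      : ∀ m r → bigSum M r ≡ ∑ (reversed m r) (suc m)
  bigSum-tail≡∑-reversed : ∀ m r → bigSum M (r ∘ Fin.suc) ≡ ∑ (reversed m r) m

  bigSum≡∑-reversed m r = trans (⊕-comm _ _)
    (cong₂ _⊕_ (bigSum-tail≡∑-reversed m r) (sym (reversed-≥ r ℕₚ.≤-refl)))

  bigSum-tail≡∑-reversed zero    r = refl
  bigSum-tail≡∑-reversed (suc m) r = trans (bigSum≡∑-reversed m (r ∘ Fin.suc))
    (∑-cong (suc m) (λ i i<1+m → sym (reversed-suc r (ℕ.s≤s⁻¹ i<1+m))))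

count : ∀ {N} {P : Fin N → Set} → (∀ i → Dec (P i)) → ℕ
count {zero}  P? = 0
count {suc N} P? with P? Fin.zero
... | yes _ = suc (count (P? ∘ Fin.suc))
... | no  _ = count (P? ∘ Fin.suc)

count-mono : ∀ {N} {P Q : Fin N → Set} (P? : ∀ i → Dec (P i)) (Q? : ∀ i → Dec (Q i)) →
             (∀ i → P i → Q i) → count P? ℕ.≤ count Q?
count-mono {zero}  P? Q? P⇒Q = z≤n
count-mono {suc N} P? Q? P⇒Q with P? Fin.zero | Q? Fin.zero
... | yes P0 | no ¬Q0 = ⊥-elim (¬Q0 (P⇒Q Fin.zero P0))
... | yes _  | yes _  = s≤s (count-mono (P? ∘ Fin.suc) (Q? ∘ Fin.suc) (P⇒Q ∘ Fin.suc))
... | no _   | yes _  = ℕₚ.m≤n⇒m≤1+n (count-mono (P? ∘ Fin.suc) (Q? ∘ Fin.suc) (P⇒Q ∘ Fin.suc))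
... | no _   | no _   = count-mono (P? ∘ Fin.suc) (Q? ∘ Fin.suc) (P⇒Q ∘ Fin.suc)

count-strict : ∀ {N} {P Q : Fin N → Set} (P? : ∀ i → Dec (P i)) (Q? : ∀ i → Dec (Q i)) →
               (∀ i → P i → Q i) → ∀ j → Q j → ¬ P j → count P? ℕ.< count Q?
count-strict {suc N} P? Q? P⇒Q Fin.zero Qj ¬Pj with P? Fin.zero | Q? Fin.zero
... | yes Pj | _      = ⊥-elim (¬Pj Pj)
... | no _   | no ¬Qj = ⊥-elim (¬Qj Qj)
... | no _   | yes _  = s≤s (count-mono (P? ∘ Fin.suc) (Q? ∘ Fin.suc) (P⇒Q ∘ Fin.suc))
count-strict {suc N} P? Q? P⇒Q (Fin.suc j) Qj ¬Pj with P? Fin.zero | Q? Fin.zero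
... | yes P0 | no ¬Q0 = ⊥-elim (¬Q0 (P⇒Q Fin.zero P0))
... | yes _  | yes _  = s≤s (count-strict (P? ∘ Fin.suc) (Q? ∘ Fin.suc) (P⇒Q ∘ Fin.suc) j Qj ¬Pj)
... | no _   | yes _  = ℕₚ.m≤n⇒m≤1+n (count-strict (P? ∘ Fin.suc) (Q? ∘ Fin.suc) (P⇒Q ∘ Fin.suc) j Qj ¬Pj)
... | no _   | no _   = count-strict (P? ∘ Fin.suc) (Q? ∘ Fin.suc) (P⇒Q ∘ Fin.suc) j Qj ¬Pj

count+count-¬ : ∀ {N} {P : Fin N → Set} (P? : ∀ i → Dec (P i)) → count P? + count (¬? ∘ P?) ≡ N
count+count-¬ {zero}  P? = refl
count+count-¬ {suc N} P? with P? Fin.zero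
... | yes _ = cong suc (count+count-¬ (P? ∘ Fin.suc))
... | no  _ = trans (ℕₚ.+-suc _ _) (cong suc (count+count-¬ (P? ∘ Fin.suc)))

injective⇒surjective : ∀ {N} (f : Fin N → Fin N) → (∀ {x y} → f x ≡ f y → x ≡ y) →
                       ∀ y → ∃ λ x → f x ≡ y
injective⇒surjective {suc N} f f-injective y with Finₚ.any? (λ x → f x Finₚ.≟ y)
... | yes found = found
... | no missed = ⊥-elim (ℕₚ.<-irrefl refl (Finₚ.injective⇒≤ {f = squeeze} squeeze-injective))
  where
  y≢f : ∀ x → y ≢ f x
  y≢f x y≡fx = missed (x , sym y≡fx)
  squeeze : Fin (suc N) → Fin N
  squeeze x = Fin.punchOut (y≢f x)
  squeeze-injective : ∀ {x x′} → squeeze x ≡ squeeze x′ → x ≡ x′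
  squeeze-injective eq = f-injective (Finₚ.punchOut-injective (y≢f _) (y≢f _) eq)

greatest : (P : ℕ → Set) → (∀ i → Dec (P i)) → P 0 → ∀ B →
           ∃ λ I → I ℕ.≤ B × P I × (∀ i → i ℕ.≤ B → P i → i ℕ.≤ I)
greatest P P? P0 zero = 0 , z≤n , P0 , λ { _ z≤n _ → z≤n }
greatest P P? P0 (suc B) with P? (suc B)
... | yes P[1+B] = suc B , ℕₚ.≤-refl , P[1+B] , λ _ i≤1+B _ → i≤1+B
... | no ¬P[1+B] with I , I≤B , PI , maximal ← greatest P P? P0 B =
  I , ℕₚ.m≤n⇒m≤1+n I≤B , PI , maximal′
  where
  maximal′ : ∀ i → i ℕ.≤ suc B → P i → i ℕ.≤ I
  maximal′ i i≤1+B Pi with ℕₚ.m≤n⇒m<n∨m≡n i≤1+B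
  ... | inj₁ i<1+B = maximal i (ℕ.s≤s⁻¹ i<1+B) Pi
  ... | inj₂ refl  = ⊥-elim (¬P[1+B] Pi)

↔-injective⇒surjective : ∀ {A B : Set} {N} → A ↔ Fin N → B ↔ Fin N → (f : A → B) →
                         (∀ {x y} → f x ≡ f y → x ≡ y) → ∀ y → ∃ λ x → f x ≡ y
↔-injective⇒surjective A↔Fin B↔Fin f f-injective y =
  A.from (proj₁ found) , B.to-injective (proj₂ found)
  where
  module A = Injection (↔⇒↣ (↔-sym A↔Fin)) renaming (to to from; injective to from-injective)
  module B = Injection (↔⇒↣ B↔Fin) renaming (injective to to-injective)
  found : ∃ λ i → B.to (f (A.from i)) ≡ B.to y
  found = injective⇒surjective (B.to ∘ f ∘ A.from) (A.from-injective ∘ f-injective ∘ B.to-injective) (B.to y)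

combine-lex-< : ∀ {m n} {i j : Fin m} {s t : Fin n} → i Fin.≤ j → (i ≡ j → s Fin.< t) →
                Fin.combine i s Fin.< Fin.combine j t
combine-lex-< {n = n} {i} {j} {s} {t} i≤j i≡j⇒s<t with i Finₚ.≟ j
... | no i≢j  = Finₚ.combine-monoˡ-< s t (Finₚ.≤∧≢⇒< i≤j i≢j)
... | yes refl = subst₂ ℕ._<_ (sym (Finₚ.toℕ-combine i s)) (sym (Finₚ.toℕ-combine i t))
                   (ℕₚ.+-monoʳ-< (n * toℕ i) (i≡j⇒s<t refl))

all?-↔ : ∀ {A : Set} {N} → A ↔ Fin N → {P : A → Set} → (∀ x → Dec (P x)) → Dec (∀ x → P x)
all?-↔ enumeration {P} P? =
  map′ (λ ∀P x → subst P (strictlyInverseʳ x) (∀P (to x))) (λ ∀P i → ∀P (from i)) (Finₚ.all? (P? ∘ from))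
  where open Inverse enumeration

all?-functions : ∀ {A : Set} → (∀ {P : A → Set} → (∀ x → Dec (P x)) → Dec (∀ x → P x)) →
                 ∀ m {Q : (Fin m → A) → Set} → (∀ {f g} → f ≗ g → Q f → Q g) →
                 (∀ f → Dec (Q f)) → Dec (∀ f → Q f)
all?-functions all? zero    Q-resp Q? =
  map′ (λ Q[] f → Q-resp (λ ()) Q[]) (λ ∀Q → ∀Q []) (Q? [])
all?-functions {A} all? (suc m) Q-resp Q? =
  map′ (λ ∀Q∷ f → Q-resp head∷tail (∀Q∷ (f Fin.zero) (f ∘ Fin.suc))) (λ ∀Q a g → ∀Q (a ∷ g))
       (all? (λ a → all?-functions all? m (λ f≗g → Q-resp (∷-cong f≗g)) (λ g → Q? (a ∷ g))))
  where
  head∷tail : ∀ {f : Fin (suc m) → A} → (f Fin.zero ∷ f ∘ Fin.suc) ≗ f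
  head∷tail Fin.zero    = refl
  head∷tail (Fin.suc i) = refl
  ∷-cong : ∀ {a} {f g : Fin m → A} → f ≗ g → (a ∷ f) ≗ (a ∷ g)
  ∷-cong f≗g Fin.zero    = refl
  ∷-cong f≗g (Fin.suc i) = f≗g i

module FiniteDistanceMonoid (M : DistanceMonoid) {n} (enumeration : HasNonZeroCount M n) where
  open DistanceMonoidProperties M
  open BigSums M
  open Inverse enumeration public using (to; from; strictlyInverseʳ)

  infix 4 _≟_ _≤?_ _<?_

  _≟_ : DecidableEquality Carrier
  _≟_ = via-injection (↔⇒↣ enumeration) Finₚ._≟_

  _≤?_ : Decidable _≤_
  _≤?_ = DecTotalOrder._≤?_ (TotalOrderProperties.decTotalOrder totalOrder _≟_)

  _<?_ : ∀ x y → Dec (x < y)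
  x <? y = (x ≤? y) ×-dec ¬? (x ≟ y)

  ∀? : {P : Carrier → Set} → (∀ x → Dec (P x)) → Dec (∀ x → P x)
  ∀? = all?-↔ enumeration

  archProperty? : ∀ m → Dec (ArchProperty M m)
  archProperty? m = all?-functions ∀? (suc m) respects
    (λ r → ascending? r →-dec (bigSum M r ≟ bigSum M (r ∘ Fin.suc)))
    where
    ascending? : ∀ r → Dec (Ascending M r)
    ascending? r = Finₚ.all? (λ i → r (inject₁ i) ≤? r (Fin.suc i))
    respects : ∀ {r r′} → r ≗ r′ → (Ascending M r → bigSum M r ≡ bigSum M (r ∘ Fin.suc)) →
               Ascending M r′ → bigSum M r′ ≡ bigSum M (r′ ∘ Fin.suc)
    respects r≗r′ arch ascending′ = trans (bigSum-cong (sym ∘ r≗r′))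
      (trans (arch (λ i → subst₂ _≤_ (sym (r≗r′ _)) (sym (r≗r′ _)) (ascending′ i))) (bigSum-cong (r≗r′ ∘ Fin.suc)))

  hasArch? : ∀ K → Dec (HasArch M K)
  hasArch? K = archProperty? K ×-dec
    map′ (λ below m m<K → below {m} m<K) (λ below {m} m<K → below m m<K) (ℕₚ.allUpTo? (¬? ∘ archProperty?) K)

  #_ : {P : Carrier → Set} → (∀ x → Dec (P x)) → ℕ
  # P? = count (P? ∘ from)

  #-mono : ∀ {P Q : Carrier → Set} (P? : ∀ x → Dec (P x)) (Q? : ∀ x → Dec (Q x)) →
           (∀ x → P x → Q x) → # P? ℕ.≤ # Q?
  #-mono P? Q? P⇒Q = count-mono (P? ∘ from) (Q? ∘ from) (P⇒Q ∘ from)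

  #-strict : ∀ {P Q : Carrier → Set} (P? : ∀ x → Dec (P x)) (Q? : ∀ x → Dec (Q x)) →
             (∀ x → P x → Q x) → ∀ x → Q x → ¬ P x → # P? ℕ.< # Q?
  #-strict {P} {Q} P? Q? P⇒Q x Qx ¬Px = count-strict (P? ∘ from) (Q? ∘ from) (P⇒Q ∘ from) (to x)
    (subst Q (sym (strictlyInverseʳ x)) Qx) (¬Px ∘ subst P (strictlyInverseʳ x))

  -- If no d had L′ · d < (L′ + 1) · d, ArchProperty L′ would hold: a sum violating it, read
  -- backwards, would force 2L′ + 2 distinct elements, more than the n + 1 that M has.
  powerChain : ∀ {L′} → HasArch M (suc L′) → n ℕ.< suc L′ + L′ → PowerChain (suc L′)
  powerChain {L′} (arch , minimal) small with Finₚ.any? (λ y → ¬? (suc L′ · from y ≟ L′ · from y))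
  ... | yes (y , strict) = record
    { generator  = from y
    ; increasing = ∑-strictlyIncreasing (λ _ → ≤-refl) L′ strict
    ; saturated  = begin
        suc (suc L′) · from y                    ≡⟨ bigSum-const (suc (suc L′)) (from y) ⟨
        bigSum M {suc (suc L′)} (const (from y)) ≡⟨ arch (const (from y)) (λ _ → ≤-refl) ⟩
        bigSum M {suc L′} (const (from y))       ≡⟨ bigSum-const (suc L′) (from y) ⟩
        suc L′ · from y                          ∎
    }
    where open ≡-Reasoning
  ... | no none = ⊥-elim (minimal L′ (ℕₚ.n<1+n L′) arch-L′)
    where
    open LongSums M _≟_
    arch-L′ : ArchProperty M L′
    arch-L′ r ascending with bigSum M r ≟ bigSum M (r ∘ Fin.suc)
    ... | yes eq = eq
    ... | no ne with ∑-strict⇒·-strict⊎large L′ L′ (reversed-nonIncreasing r ascending) (λ i → reversed-≥ r)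
                       ℕₚ.≤-refl (λ eq → ne (trans (bigSum≡∑-reversed L′ r)
                                                   (trans eq (sym (bigSum-tail≡∑-reversed L′ r)))))
    ...   | inj₁ strict = ⊥-elim (none (to (r Fin.zero) ,
                            subst (λ x → suc L′ · x ≢ L′ · x) (sym (strictlyInverseʳ (r Fin.zero))) strict))
    ...   | inj₂ large  = ⊥-elim (ℕₚ.<⇒≱ small
                            (ℕ.s≤s⁻¹ (Finₚ.injective⇒≤ (Injection.injective (↔⇒↣ enumeration ↣-∘ large)))))

module _ {R S : DistanceMonoid} (R≅S : R ≅ S) where
  private
    module R = DistanceMonoid R
    module S = DistanceMonoidProperties S
  open _≅_ R≅S

  ≅-to-injective : ∀ {x y} → to x ≡ to y → x ≡ y
  ≅-to-injective {x} {y} tx≡ty = trans (sym (from∘to x)) (trans (cong from tx≡ty) (from∘to y))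

  ≅-sym : S ≅ R
  ≅-sym = record
    { to         = from
    ; from       = to
    ; from∘to    = to∘from
    ; to∘from    = from∘to
    ; to-⊕       = λ x y → ≅-to-injective (trans (to∘from _)
                     (trans (cong₂ S._⊕_ (sym (to∘from x)) (sym (to∘from y))) (sym (to-⊕ _ _))))
    ; to-𝟘       = ≅-to-injective (trans (to∘from _) (sym to-𝟘))
    ; to-mono    = λ x≤y → to-reflect (subst₂ S._≤_ (sym (to∘from _)) (sym (to∘from _)) x≤y)
    ; to-reflect = λ fx≤fy → subst₂ S._≤_ (to∘from _) (to∘from _) (to-mono fx≤fy)
    }

  ≅-to-bigSum : ∀ {m} (r : Fin m → R.Carrier) → to (bigSum R r) ≡ bigSum S (to ∘ r)
  ≅-to-bigSum {zero}  r = to-𝟘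
  ≅-to-bigSum {suc m} r = trans (to-⊕ _ _) (cong (to (r Fin.zero) S.⊕_) (≅-to-bigSum (r ∘ Fin.suc)))

  ≅-archProperty : ∀ {m} → ArchProperty R m → ArchProperty S m
  ≅-archProperty arch r ascending = begin
    bigSum S r                        ≡⟨ S.bigSum-cong (sym ∘ to∘from ∘ r) ⟩
    bigSum S (to ∘ from ∘ r)          ≡⟨ ≅-to-bigSum (from ∘ r) ⟨
    to (bigSum R (from ∘ r))          ≡⟨ cong to (arch (from ∘ r) ascending′) ⟩
    to (bigSum R (from ∘ r ∘ Fin.suc)) ≡⟨ ≅-to-bigSum (from ∘ r ∘ Fin.suc) ⟩
    bigSum S (to ∘ from ∘ r ∘ Fin.suc) ≡⟨ S.bigSum-cong (to∘from ∘ r ∘ Fin.suc) ⟩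
    bigSum S (r ∘ Fin.suc)            ∎
    where
    open ≡-Reasoning
    ascending′ : Ascending R (from ∘ r)
    ascending′ i = to-reflect (subst₂ S._≤_ (sym (to∘from _)) (sym (to∘from _)) (ascending i))

≅-hasArch : ∀ {R S K} → R ≅ S → HasArch R K → HasArch S K
≅-hasArch R≅S (arch , minimal) =
  ≅-archProperty R≅S arch , λ m m<K arch-m → minimal m m<K (≅-archProperty (≅-sym R≅S) arch-m)

clamp : ∀ L → ℕ → Fin (suc L)
clamp L m = fromℕ< (s≤s (ℕₚ.m⊓n≤n m L))

toℕ-clamp : ∀ L m → toℕ (clamp L m) ≡ m ⊓ L
toℕ-clamp L m = Finₚ.toℕ-fromℕ< (s≤s (ℕₚ.m⊓n≤n m L))

-- The carrier of a monoid in normal form: the multiples 0 · d, …, L · d of a fixed d, and k gaps.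
Element : ℕ → ℕ → Set
Element L k = Fin (suc L) ⊎ Fin k

elementEnumeration : ∀ {L k n} → suc L + k ≡ suc n → Element L k ↔ Fin (suc n)
elementEnumeration {L} {k} size = subst (λ N → Element L k ↔ Fin N) size (↔-sym (Finₚ.+↔⊎ {suc L} {k}))

power : ∀ {L k} → ℕ → Element L k
power {L} m = inj₁ (clamp L m)

-- A gap, or the power at offset 0, 1 or 2 from a base index. Three offsets suffice because a gap
-- of level I lies strictly between I · d and (I + 1) · d.
Descriptor : ℕ → Set
Descriptor k = Fin k ⊎ Fin 3

locate : ∀ {L k} → ℕ → Descriptor k → Element L k
locate base (inj₁ b) = inj₂ b
locate base (inj₂ t) = power (base + toℕ t)

describe : ∀ {L k} → ℕ → Element L k → Descriptor k
describe base (inj₁ m) = inj₂ (clamp 2 (toℕ m ∸ base))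
describe base (inj₂ b) = inj₁ b

InWindow : ∀ {L k} → ℕ → Element L k → Set
InWindow {L} base x = ∀ {m} → x ≡ inj₁ m → base ⊓ L ℕ.≤ toℕ m × toℕ m ℕ.≤ (base + 2) ⊓ L

window-offset : ∀ {L base m} → base ⊓ L ℕ.≤ m → m ℕ.≤ (base + 2) ⊓ L → (base + (m ∸ base) ⊓ 2) ⊓ L ≡ m
window-offset {L} {base} {m} lower upper with ℕₚ.≤-total base L
... | inj₁ base≤L = begin
  (base + (m ∸ base) ⊓ 2) ⊓ L ≡⟨ cong (λ t → (base + t) ⊓ L) (ℕₚ.m≤n⇒m⊓n≡m m∸base≤2) ⟩
  (base + (m ∸ base)) ⊓ L     ≡⟨ cong (_⊓ L) base+[m∸base]≡m ⟩
  m ⊓ L                       ≡⟨ ℕₚ.m≤n⇒m⊓n≡m (ℕₚ.≤-trans upper (ℕₚ.m⊓n≤n _ L)) ⟩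
  m                           ∎
  where
  open ≡-Reasoning
  base+[m∸base]≡m : base + (m ∸ base) ≡ m
  base+[m∸base]≡m = ℕₚ.m+[n∸m]≡n (subst (ℕ._≤ m) (ℕₚ.m≤n⇒m⊓n≡m base≤L) lower)
  m∸base≤2 : m ∸ base ℕ.≤ 2
  m∸base≤2 = ℕₚ.+-cancelˡ-≤ base _ 2
    (subst (ℕ._≤ base + 2) (sym base+[m∸base]≡m) (ℕₚ.≤-trans upper (ℕₚ.m⊓n≤m _ L)))
... | inj₂ L≤base = trans (ℕₚ.m≥n⇒m⊓n≡n (ℕₚ.≤-trans L≤base (ℕₚ.m≤m+n base _)))
  (ℕₚ.≤-antisym (subst (ℕ._≤ m) (ℕₚ.m≥n⇒m⊓n≡n L≤base) lower) (ℕₚ.≤-trans upper (ℕₚ.m⊓n≤n _ L)))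

locate-describe : ∀ {L k} base (x : Element L k) → InWindow base x → locate base (describe base x) ≡ x
locate-describe base (inj₂ b) _ = refl
locate-describe {L} base (inj₁ m) inWindow = cong inj₁ (Finₚ.toℕ-injective (begin
  toℕ (clamp L (base + toℕ (clamp 2 (toℕ m ∸ base)))) ≡⟨ toℕ-clamp L _ ⟩
  (base + toℕ (clamp 2 (toℕ m ∸ base))) ⊓ L           ≡⟨ cong (λ t → (base + t) ⊓ L) (toℕ-clamp 2 _) ⟩
  (base + (toℕ m ∸ base) ⊓ 2) ⊓ L                     ≡⟨ window-offset lower upper ⟩
  toℕ m                                               ∎))
  where
  open ≡-Reasoning
  lower : base ⊓ L ℕ.≤ toℕ m
  lower = proj₁ (inWindow refl)
  upper : toℕ m ℕ.≤ (base + 2) ⊓ L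
  upper = proj₂ (inWindow refl)

-- level a is the level of gap a; step a and sum a b locate gap a ⊕ d and gap a ⊕ gap b relative
-- to the bases level a + 1 and level a + level b.
record Code (L k : ℕ) : Set where
  field
    level : Fin k → Fin (suc L)
    step  : Fin k → Descriptor k
    sum   : Fin k → Fin k → Descriptor k

record _≈ᶜ_ {L k} (code code′ : Code L k) : Set where
  field
    level-≈ : ∀ a → Code.level code a ≡ Code.level code′ a
    step-≈  : ∀ a → Code.step code a ≡ Code.step code′ a
    sum-≈   : ∀ a b → Code.sum code a b ≡ Code.sum code′ a b

tableCount : ℕ → ℕ
tableCount k = (k + 3) ^ k * ((k + 3) ^ k) ^ k

codeCount : ℕ → ℕ → ℕ
codeCount L k = suc L ^ k * tableCount k

module _ {L k : ℕ} where

  decodeCode : Fin (codeCount L k) → Code L k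
  decodeCode c = record
    { level = Fin.finToFun levels
    ; step  = Fin.splitAt k ∘ Fin.finToFun steps
    ; sum   = λ a → Fin.splitAt k ∘ Fin.finToFun (Fin.finToFun sums a)
    }
    where
    descriptorRows : Fin ((k + 3) ^ k * ((k + 3) ^ k) ^ k)
    descriptorRows = proj₂ (Fin.remQuot {suc L ^ k} _ c)
    levels : Fin (suc L ^ k)
    levels = proj₁ (Fin.remQuot {suc L ^ k} _ c)
    steps : Fin ((k + 3) ^ k)
    steps = proj₁ (Fin.remQuot {(k + 3) ^ k} _ descriptorRows)
    sums : Fin (((k + 3) ^ k) ^ k)
    sums = proj₂ (Fin.remQuot {(k + 3) ^ k} _ descriptorRows)

  encodeCode : Code L k → Fin (codeCount L k)
  encodeCode code = Fin.combine (Fin.funToFin level)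
    (Fin.combine (Fin.funToFin (Fin.join k 3 ∘ step)) (Fin.funToFin (λ a → Fin.funToFin (Fin.join k 3 ∘ sum a))))
    where open Code code

  decode-encodeCode : ∀ code → decodeCode (encodeCode code) ≈ᶜ code
  decode-encodeCode code = record
    { level-≈ = λ a → trans (cong (λ c → Fin.finToFun c a) (cong proj₁ outer)) (Finₚ.finToFun-funToFin level a)
    ; step-≈  = λ a → trans (cong (λ c → Fin.splitAt k (Fin.finToFun c a)) (cong proj₁ inner))
                        (trans (cong (Fin.splitAt k) (Finₚ.finToFun-funToFin _ a)) (Finₚ.splitAt-join k 3 (step a)))
    ; sum-≈   = λ a b → trans (cong (λ c → Fin.splitAt k (Fin.finToFun (Fin.finToFun c a) b)) (cong proj₂ inner))
                          (trans (cong (λ c → Fin.splitAt k (Fin.finToFun c b)) (Finₚ.finToFun-funToFin _ a))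
                            (trans (cong (Fin.splitAt k) (Finₚ.finToFun-funToFin _ b)) (Finₚ.splitAt-join k 3 (sum a b))))
    }
    where
    open Code code
    steps : Fin ((k + 3) ^ k)
    steps = Fin.funToFin (Fin.join k 3 ∘ step)
    sums : Fin (((k + 3) ^ k) ^ k)
    sums = Fin.funToFin (λ a → Fin.funToFin (Fin.join k 3 ∘ sum a))
    outer : Fin.remQuot {suc L ^ k} _ (encodeCode code) ≡ (Fin.funToFin level , Fin.combine steps sums)
    outer = Finₚ.remQuot-combine (Fin.funToFin level) _
    inner : Fin.remQuot {(k + 3) ^ k} _ (proj₂ (Fin.remQuot {suc L ^ k} _ (encodeCode code))) ≡ (steps , sums)
    inner = trans (cong (Fin.remQuot _ ∘ proj₂) outer) (Finₚ.remQuot-combine steps sums)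

module Model {L k : ℕ} (code : Code L k) where
  open Code code

  -- next x represents x ⊕ d.
  next : Element L k → Element L k
  next (inj₁ i) = power (suc (toℕ i))
  next (inj₂ a) = locate (suc (toℕ (level a))) (step a)

  infixl 6 _⊕ᴱ_
  _⊕ᴱ_ : Element L k → Element L k → Element L k
  inj₁ i ⊕ᴱ inj₁ j = power (toℕ i + toℕ j)
  inj₁ i ⊕ᴱ inj₂ b = iterate next (inj₂ b) (toℕ i)
  inj₂ a ⊕ᴱ inj₁ j = iterate next (inj₂ a) (toℕ j)
  inj₂ a ⊕ᴱ inj₂ b = locate (toℕ (level a) + toℕ (level b)) (sum a b)

  height : Element L k → Fin (suc L)
  height (inj₁ i) = i
  height (inj₂ a) = level a

  slot : Element L k → Fin (suc k)
  slot (inj₁ _) = Fin.zero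
  slot (inj₂ a) = Fin.suc a

  -- Lexicographic in (height, slot): a power precedes the gaps of its level.
  key : Element L k → Fin (suc L * suc k)
  key x = Fin.combine (height x) (slot x)

  infix 4 _≤ᴱ_
  _≤ᴱ_ : Element L k → Element L k → Set
  x ≤ᴱ y = key x Fin.≤ key y

  key-injective : ∀ {x y} → key x ≡ key y → x ≡ y
  key-injective {inj₁ i} {inj₁ j} eq = cong inj₁ (proj₁ (Finₚ.combine-injective i _ j _ eq))
  key-injective {inj₁ i} {inj₂ b} eq with () ← proj₂ (Finₚ.combine-injective i _ (level b) _ eq)
  key-injective {inj₂ a} {inj₁ j} eq with () ← proj₂ (Finₚ.combine-injective (level a) _ j _ eq)
  key-injective {inj₂ a} {inj₂ b} eq =
    cong inj₂ (Finₚ.suc-injective (proj₂ (Finₚ.combine-injective (level a) _ (level b) _ eq)))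

  ≤ᴱ-isTotalOrder : IsTotalOrder _≡_ _≤ᴱ_
  ≤ᴱ-isTotalOrder = record
    { isPartialOrder = record
      { isPreorder = record
        { isEquivalence = isEquivalence
        ; reflexive     = λ { refl → Finₚ.≤-refl }
        ; trans         = Finₚ.≤-trans
        }
      ; antisym = λ x≤y y≤x → key-injective (Finₚ.≤-antisym x≤y y≤x)
      }
    ; total = λ x y → Finₚ.≤-total (key x) (key y)
    }

  record Axioms : Set where
    field
      ≤-⊕ᴱ        : ∀ r s → r ≤ᴱ r ⊕ᴱ s
      ⊕ᴱ-mono      : ∀ r s t u → r ≤ᴱ t → s ≤ᴱ u → r ⊕ᴱ s ≤ᴱ t ⊕ᴱ u
      ⊕ᴱ-comm      : ∀ r s → r ⊕ᴱ s ≡ s ⊕ᴱ r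
      ⊕ᴱ-assoc     : ∀ r s t → (r ⊕ᴱ s) ⊕ᴱ t ≡ r ⊕ᴱ (s ⊕ᴱ t)
      ⊕ᴱ-identityʳ : ∀ r → r ⊕ᴱ power 0 ≡ r

  axioms? : Dec Axioms
  axioms? = map′
    (λ (a , b , c , d , e) → record { ≤-⊕ᴱ = a ; ⊕ᴱ-mono = b ; ⊕ᴱ-comm = c ; ⊕ᴱ-assoc = d ; ⊕ᴱ-identityʳ = e })
    (λ ax → let open Axioms ax in ≤-⊕ᴱ , ⊕ᴱ-mono , ⊕ᴱ-comm , ⊕ᴱ-assoc , ⊕ᴱ-identityʳ)
    ( (∀? λ r → ∀? λ s → key r Finₚ.≤? key (r ⊕ᴱ s))
    ×-dec (∀? λ r → ∀? λ s → ∀? λ t → ∀? λ u →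
            (key r Finₚ.≤? key t) →-dec (key s Finₚ.≤? key u) →-dec (key (r ⊕ᴱ s) Finₚ.≤? key (t ⊕ᴱ u)))
    ×-dec (∀? λ r → ∀? λ s → r ⊕ᴱ s ≟ᴱ s ⊕ᴱ r)
    ×-dec (∀? λ r → ∀? λ s → ∀? λ t → (r ⊕ᴱ s) ⊕ᴱ t ≟ᴱ r ⊕ᴱ (s ⊕ᴱ t))
    ×-dec (∀? λ r → r ⊕ᴱ power 0 ≟ᴱ r))
    where
    ∀? : {P : Element L k → Set} → (∀ x → Dec (P x)) → Dec (∀ x → P x)
    ∀? = all?-↔ (↔-sym Finₚ.+↔⊎)
    infix 4 _≟ᴱ_
    _≟ᴱ_ : DecidableEquality (Element L k)
    _≟ᴱ_ = via-injection (↔⇒↣ (↔-sym Finₚ.+↔⊎)) Finₚ._≟_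

  monoid : Axioms → DistanceMonoid
  monoid ax = record
    { Carrier      = Element L k
    ; _⊕_          = _⊕ᴱ_
    ; _≤_          = _≤ᴱ_
    ; 𝟘            = power 0
    ; isTotalOrder = ≤ᴱ-isTotalOrder
    ; ≤-⊕          = ≤-⊕ᴱ
    ; ⊕-mono       = λ {r s t u} → ⊕ᴱ-mono r s t u
    ; ⊕-comm       = ⊕ᴱ-comm
    ; ⊕-assoc      = ⊕ᴱ-assoc
    ; ⊕-identityʳ  = ⊕ᴱ-identityʳ
    }
    where open Axioms ax

module NormalForm (M : DistanceMonoid) {n} (enumeration : HasNonZeroCount M n) {L k} (size : suc L + k ≡ suc n)
                  (chain : DistanceMonoidProperties.PowerChain M L) where
  open DistanceMonoidProperties M
  open FiniteDistanceMonoid M enumeration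
  open PowerChain chain renaming (generator to d; increasing to d-increasing; saturated to d-absorbing)

  p : ℕ → Carrier
  p i = i · d

  p-saturates : ∀ m → p m ≡ p (m ⊓ L)
  p-saturates m with ℕₚ.≤-total m L
  ... | inj₁ m≤L = cong p (sym (ℕₚ.m≤n⇒m⊓n≡m m≤L))
  ... | inj₂ L≤m = trans (·-absorbs L d-absorbing m L≤m) (cong p (sym (ℕₚ.m≥n⇒m⊓n≡n L≤m)))

  p-mono : ∀ {i j} → i ℕ.≤ j → p i ≤ p j
  p-mono = ∑-mono-≤ (const d)

  p≤p[L] : ∀ m → p m ≤ p L
  p≤p[L] m = subst (_≤ p L) (sym (p-saturates m)) (p-mono (ℕₚ.m⊓n≤n m L))

  p-+ : ∀ i j → p i ⊕ p j ≡ p (i + j)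
  p-+ i j = sym (·-distribʳ-+ d i j)

  p-reflects-< : ∀ {i j} → i ℕ.≤ L → j ℕ.≤ L → p i < p j → i ℕ.< j
  p-reflects-< = strictlyIncreasing-reflects-< d-increasing

  p-injective : ∀ {i j} → i ℕ.≤ L → j ℕ.≤ L → p i ≡ p j → i ≡ j
  p-injective = strictlyIncreasing-injective d-increasing

  p≤p⇒⊓≤ : ∀ {a m} → m ℕ.≤ L → p a ≤ p m → a ⊓ L ℕ.≤ m
  p≤p⇒⊓≤ {a} {m} m≤L pa≤pm = strictlyIncreasing-reflects-≤ d-increasing (ℕₚ.m⊓n≤n a L)
    (subst (_≤ p m) (p-saturates a) pa≤pm)

  p≤p⇒≤⊓ : ∀ {a m} → m ℕ.≤ L → p m ≤ p a → m ℕ.≤ a ⊓ L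
  p≤p⇒≤⊓ {a} {m} m≤L pm≤pa =
    strictlyIncreasing-reflects-≤ d-increasing m≤L (subst (p m ≤_) (p-saturates a) pm≤pa)

  index≤L : (i : Fin (suc L)) → toℕ i ℕ.≤ L
  index≤L i = ℕ.s≤s⁻¹ (Finₚ.toℕ<n i)

  IsPower : Carrier → Set
  IsPower x = ∃ λ (i : Fin (suc L)) → p (toℕ i) ≡ x

  isPower? : ∀ x → Dec (IsPower x)
  isPower? x = Finₚ.any? (λ i → p (toℕ i) ≟ x)

  p-isPower : ∀ {m} → m ℕ.≤ L → IsPower (p m)
  p-isPower m≤L = fromℕ< (s≤s m≤L) , cong p (Finₚ.toℕ-fromℕ< (s≤s m≤L))

  Gap : Carrier → Set
  Gap x = ¬ IsPower x

  powerBelow? : ∀ t x → Dec (∃ λ (i : Fin (suc L)) → toℕ i ℕ.< t × p (toℕ i) ≡ x)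
  powerBelow? t x = Finₚ.any? (λ i → (toℕ i ℕ.<? t) ×-dec (p (toℕ i) ≟ x))

  #powerBelow : ∀ t → t ℕ.≤ suc L → t ℕ.≤ # (powerBelow? t)
  #powerBelow zero    _       = z≤n
  #powerBelow (suc t) t<1+L = ℕₚ.≤-<-trans (#powerBelow t (ℕₚ.<⇒≤ t<1+L))
    (#-strict (powerBelow? t) (powerBelow? (suc t)) (λ _ (i , i<t , eq) → i , ℕₚ.m<n⇒m<1+n i<t , eq)
      (p t) (i , ℕₚ.≤-reflexive (cong suc toℕ-i) , cong p toℕ-i)
      (λ (j , j<t , pj≡pt) → ℕₚ.<⇒≢ j<t (p-injective (index≤L j) (ℕ.s≤s⁻¹ t<1+L) pj≡pt)))
    where
    i : Fin (suc L)
    i = fromℕ< t<1+L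
    toℕ-i : toℕ i ≡ t
    toℕ-i = Finₚ.toℕ-fromℕ< t<1+L

  #gaps≤k : # (¬? ∘ isPower?) ℕ.≤ k
  #gaps≤k = ℕₚ.+-cancelˡ-≤ (suc L) _ _ (begin
    suc L + # (¬? ∘ isPower?)      ≤⟨ ℕₚ.+-monoˡ-≤ _ #powers ⟩
    # isPower? + # (¬? ∘ isPower?) ≡⟨ count+count-¬ (isPower? ∘ from) ⟩
    suc n                          ≡⟨ size ⟨
    suc L + k                      ∎)
    where
    open ℕₚ.≤-Reasoning
    #powers : suc L ℕ.≤ # isPower?
    #powers = ℕₚ.≤-trans (#powerBelow (suc L) ℕₚ.≤-refl)
                         (#-mono (powerBelow? (suc L)) isPower? (λ _ (i , _ , eq) → i , eq))

  gapBelow? : ∀ x y → Dec (Gap y × y < x)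
  gapBelow? x y = ¬? (isPower? y) ×-dec (y <? x)

  rank : Carrier → ℕ
  rank x = # (gapBelow? x)

  rank<k : ∀ {x} → Gap x → rank x ℕ.< k
  rank<k {x} gap = ℕₚ.<-≤-trans
    (#-strict (gapBelow? x) (¬? ∘ isPower?) (λ _ → proj₁) x gap (λ (_ , x<x) → <-irrefl refl x<x)) #gaps≤k

  rank-strict : ∀ {x y} → Gap x → x < y → rank x ℕ.< rank y
  rank-strict {x} {y} gap x<y = #-strict (gapBelow? x) (gapBelow? y)
    (λ _ (gap-z , z<x) → gap-z , <-trans z<x x<y) x (gap , x<y) (λ (_ , x<x) → <-irrefl refl x<x)

  rank-injective : ∀ {x y} → Gap x → Gap y → rank x ≡ rank y → x ≡ y
  rank-injective {x} {y} gap-x gap-y rx≡ry with x ≟ y | total x y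
  ... | yes x≡y | _        = x≡y
  ... | no x≢y  | inj₁ x≤y = ⊥-elim (ℕₚ.<-irrefl rx≡ry (rank-strict gap-x (x≤y , x≢y)))
  ... | no x≢y  | inj₂ y≤x = ⊥-elim (ℕₚ.<-irrefl (sym rx≡ry) (rank-strict gap-y (y≤x , x≢y ∘ sym)))

  -- Gaps are numbered by rank, the number of gaps below them, so the numbering respects the order.
  encodeWith : ∀ x → Dec (IsPower x) → Element L k
  encodeWith x (yes (i , _)) = inj₁ i
  encodeWith x (no gap)      = inj₂ (fromℕ< (rank<k gap))

  encode : Carrier → Element L k
  encode x = encodeWith x (isPower? x)

  encodeWith-injective : ∀ {x y} dx dy → encodeWith x dx ≡ encodeWith y dy → x ≡ y
  encodeWith-injective (yes (i , pi≡x)) (yes (.i , pi≡y)) refl = trans (sym pi≡x) pi≡y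
  encodeWith-injective (no gap-x) (no gap-y) eq = rank-injective gap-x gap-y (begin
    rank _                          ≡⟨ Finₚ.toℕ-fromℕ< (rank<k gap-x) ⟨
    toℕ (fromℕ< (rank<k gap-x))     ≡⟨ cong toℕ (inj₂-injective eq) ⟩
    toℕ (fromℕ< (rank<k gap-y))     ≡⟨ Finₚ.toℕ-fromℕ< (rank<k gap-y) ⟩
    rank _                          ∎)
    where open ≡-Reasoning
  encodeWith-injective (yes _) (no _) ()
  encodeWith-injective (no _) (yes _) ()

  encode-injective : ∀ {x y} → encode x ≡ encode y → x ≡ y
  encode-injective = encodeWith-injective (isPower? _) (isPower? _)

  -- Opaque, like gapLevel-spec and Candidate.candidate: these run searches over the carrier,
  -- and type checking must never unfold them.
  opaque
    encode-surjective : ∀ e → ∃ λ x → encode x ≡ e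
    encode-surjective = ↔-injective⇒surjective enumeration (elementEnumeration size) encode encode-injective

  decode : Element L k → Carrier
  decode e = proj₁ (encode-surjective e)

  encode-decode : ∀ e → encode (decode e) ≡ e
  encode-decode e = proj₂ (encode-surjective e)

  decode-encode : ∀ x → decode (encode x) ≡ x
  decode-encode x = encode-injective (encode-decode (encode x))

  encode-p-index : ∀ (i : Fin (suc L)) → encode (p (toℕ i)) ≡ inj₁ i
  encode-p-index i with isPower? (p (toℕ i))
  ... | yes (j , pj≡pi) = cong inj₁ (Finₚ.toℕ-injective (p-injective (index≤L j) (index≤L i) pj≡pi))
  ... | no gap          = ⊥-elim (gap (i , refl))

  encode-p : ∀ m → encode (p m) ≡ power m
  encode-p m = trans (cong encode (trans (p-saturates m) (cong p (sym (toℕ-clamp L m)))))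
                     (encode-p-index (clamp L m))

  decode-inj₁ : ∀ i → decode (inj₁ i) ≡ p (toℕ i)
  decode-inj₁ i = encode-injective (trans (encode-decode (inj₁ i)) (sym (encode-p-index i)))

  encode≡inj₁ : ∀ {x i} → encode x ≡ inj₁ i → x ≡ p (toℕ i)
  encode≡inj₁ {i = i} eq = encode-injective (trans eq (sym (encode-p-index i)))

  encode≡inj₂ : ∀ {x a} → encode x ≡ inj₂ a → Gap x × rank x ≡ toℕ a
  encode≡inj₂ {x} eq with isPower? x
  ... | no gap = gap , trans (sym (Finₚ.toℕ-fromℕ< (rank<k gap))) (cong toℕ (inj₂-injective eq))

  gap : Fin k → Carrier
  gap a = decode (inj₂ a)

  gap-isGap : ∀ a → Gap (gap a)
  gap-isGap a = proj₁ (encode≡inj₂ (encode-decode (inj₂ a)))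

  rank-gap : ∀ a → rank (gap a) ≡ toℕ a
  rank-gap a = proj₂ (encode≡inj₂ (encode-decode (inj₂ a)))

  opaque
    gapLevel-spec : ∀ a → ∃ λ I → I ℕ.≤ L × p I < gap a × (∀ i → i ℕ.≤ L → p i < gap a → i ℕ.≤ I)
    gapLevel-spec a = greatest (λ i → p i < gap a) (λ i → p i <? gap a)
      (𝟘-least (gap a) , λ 𝟘≡gap → gap-isGap a (Fin.zero , 𝟘≡gap)) L

  gapLevel : Fin k → ℕ
  gapLevel a = proj₁ (gapLevel-spec a)

  gapLevel≤L : ∀ a → gapLevel a ℕ.≤ L
  gapLevel≤L a = proj₁ (proj₂ (gapLevel-spec a))

  p[gapLevel]<gap : ∀ a → p (gapLevel a) < gap a
  p[gapLevel]<gap a = proj₁ (proj₂ (proj₂ (gapLevel-spec a)))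

  gapLevel-maximal : ∀ a i → i ℕ.≤ L → p i < gap a → i ℕ.≤ gapLevel a
  gapLevel-maximal a = proj₂ (proj₂ (proj₂ (gapLevel-spec a)))

  gap<p[1+gapLevel] : ∀ a → gapLevel a ℕ.< L → gap a < p (suc (gapLevel a))
  gap<p[1+gapLevel] a I<L with total (gap a) (p (suc (gapLevel a)))
  ... | inj₁ gap≤p = gap≤p , λ gap≡p → gap-isGap a (subst IsPower (sym gap≡p) (p-isPower I<L))
  ... | inj₂ p≤gap = ⊥-elim (ℕₚ.<-irrefl refl (gapLevel-maximal a _ I<L
                       (p≤gap , λ p≡gap → gap-isGap a (subst IsPower p≡gap (p-isPower I<L)))))

  gap≤p⇒gapLevel<L : ∀ {a m} → gap a ≤ p m → gapLevel a ℕ.< L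
  gap≤p⇒gapLevel<L {a} {m} gap≤pm with ℕₚ.m≤n⇒m<n∨m≡n (gapLevel≤L a)
  ... | inj₁ I<L = I<L
  ... | inj₂ I≡L = ⊥-elim (<⇒≱ (subst (λ I → p I < gap a) I≡L (p[gapLevel]<gap a)) (≤-trans gap≤pm (p≤p[L] m)))

  canonicalCode : Code L k
  canonicalCode = record
    { level = λ a → fromℕ< (s≤s (gapLevel≤L a))
    ; step  = λ a → describe (suc (gapLevel a)) (encode (gap a ⊕ d))
    ; sum   = λ a b → describe (gapLevel a + gapLevel b) (encode (gap a ⊕ gap b))
    }

  step-inWindow : ∀ a → InWindow (suc (gapLevel a)) (encode (gap a ⊕ d))
  step-inWindow a {m} eq = lower , upper
    where
    I = gapLevel a
    gap⊕d≡pm : gap a ⊕ d ≡ p (toℕ m)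
    gap⊕d≡pm = encode≡inj₁ eq
    lower : suc I ⊓ L ℕ.≤ toℕ m
    lower = p≤p⇒⊓≤ (index≤L m) (subst (p (suc I) ≤_) gap⊕d≡pm (⊕-monoˡ-≤ d (<⇒≤ (p[gapLevel]<gap a))))
    I<L : I ℕ.< L
    I<L = gap≤p⇒gapLevel<L {m = toℕ m} (subst (gap a ≤_) gap⊕d≡pm (≤-⊕ (gap a) d))
    upper : toℕ m ℕ.≤ (suc I + 2) ⊓ L
    upper = ℕₚ.≤-trans
      (p≤p⇒≤⊓ (index≤L m) (subst (_≤ p (2 + I)) gap⊕d≡pm (⊕-monoˡ-≤ d (<⇒≤ (gap<p[1+gapLevel] a I<L)))))
      (ℕₚ.⊓-monoˡ-≤ L (ℕₚ.≤-trans (ℕₚ.n≤1+n _) (ℕₚ.≤-reflexive (ℕₚ.+-comm 2 (suc I)))))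

  sum-inWindow : ∀ a b → InWindow (gapLevel a + gapLevel b) (encode (gap a ⊕ gap b))
  sum-inWindow a b {m} eq = lower , upper
    where
    Iᵃ = gapLevel a
    Iᵇ = gapLevel b
    sum≡pm : gap a ⊕ gap b ≡ p (toℕ m)
    sum≡pm = encode≡inj₁ eq
    lower : (Iᵃ + Iᵇ) ⊓ L ℕ.≤ toℕ m
    lower = p≤p⇒⊓≤ (index≤L m)
      (subst₂ _≤_ (p-+ Iᵃ Iᵇ) sum≡pm (⊕-mono (<⇒≤ (p[gapLevel]<gap a)) (<⇒≤ (p[gapLevel]<gap b))))
    upper : toℕ m ℕ.≤ (Iᵃ + Iᵇ + 2) ⊓ L
    upper = p≤p⇒≤⊓ (index≤L m) (subst₂ _≤_ sum≡pm
      (trans (p-+ (suc Iᵃ) (suc Iᵇ)) (cong p (trans (cong suc (ℕₚ.+-suc Iᵃ Iᵇ)) (ℕₚ.+-comm 2 (Iᵃ + Iᵇ)))))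
      (⊕-mono (<⇒≤ (gap<p[1+gapLevel] a (gap≤p⇒gapLevel<L {m = toℕ m} (subst (gap a ≤_) sum≡pm (≤-⊕ _ _)))))
              (<⇒≤ (gap<p[1+gapLevel] b (gap≤p⇒gapLevel<L {m = toℕ m} (subst (gap b ≤_) sum≡pm (≤-⊕ˡ _ _)))))))

  module _ (code : Code L k) (code≈canonical : code ≈ᶜ canonicalCode) where
    open Model code
    open _≈ᶜ_ code≈canonical

    toℕ-level : ∀ a → toℕ (Code.level code a) ≡ gapLevel a
    toℕ-level a = trans (cong toℕ (level-≈ a)) (Finₚ.toℕ-fromℕ< (s≤s (gapLevel≤L a)))

    encode-⊕d′ : ∀ e → encode (decode e ⊕ d) ≡ next e
    encode-⊕d′ (inj₁ i) = trans (cong (λ x → encode (x ⊕ d)) (decode-inj₁ i)) (encode-p (suc (toℕ i)))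
    encode-⊕d′ (inj₂ a) = sym (begin
      locate (suc (toℕ (Code.level code a))) (Code.step code a)          ≡⟨ cong₂ locate (cong suc (toℕ-level a)) (step-≈ a) ⟩
      locate (suc (gapLevel a)) (describe _ (encode (gap a ⊕ d)))        ≡⟨ locate-describe _ _ (step-inWindow a) ⟩
      encode (gap a ⊕ d)                                                 ∎)
      where open ≡-Reasoning

    encode-⊕d : ∀ x → encode (x ⊕ d) ≡ next (encode x)
    encode-⊕d x = trans (cong (λ y → encode (y ⊕ d)) (sym (decode-encode x))) (encode-⊕d′ (encode x))

    encode-⊕p : ∀ j x → encode (x ⊕ p j) ≡ iterate next (encode x) j
    encode-⊕p zero    x = cong encode (⊕-identityʳ x)
    encode-⊕p (suc j) x = begin
      encode (x ⊕ (p j ⊕ d))          ≡⟨ cong encode (trans (sym (⊕-assoc x (p j) d)) (⊕-swapʳ x (p j) d)) ⟩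
      encode ((x ⊕ d) ⊕ p j)          ≡⟨ encode-⊕p j (x ⊕ d) ⟩
      iterate next (encode (x ⊕ d)) j ≡⟨ cong (λ e → iterate next e j) (encode-⊕d x) ⟩
      iterate next (next (encode x)) j ∎
      where open ≡-Reasoning

    encode-⊕′ : ∀ e e′ → encode (decode e ⊕ decode e′) ≡ e ⊕ᴱ e′
    encode-⊕′ (inj₁ i) (inj₁ j) = begin
      encode (decode (inj₁ i) ⊕ decode (inj₁ j)) ≡⟨ cong₂ (λ x y → encode (x ⊕ y)) (decode-inj₁ i) (decode-inj₁ j) ⟩
      encode (p (toℕ i) ⊕ p (toℕ j))             ≡⟨ cong encode (p-+ (toℕ i) (toℕ j)) ⟩
      encode (p (toℕ i + toℕ j))                 ≡⟨ encode-p (toℕ i + toℕ j) ⟩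
      power (toℕ i + toℕ j)                      ∎
      where open ≡-Reasoning
    encode-⊕′ (inj₁ i) (inj₂ b) = begin
      encode (decode (inj₁ i) ⊕ gap b)      ≡⟨ cong (λ x → encode (x ⊕ gap b)) (decode-inj₁ i) ⟩
      encode (p (toℕ i) ⊕ gap b)            ≡⟨ cong encode (⊕-comm _ _) ⟩
      encode (gap b ⊕ p (toℕ i))            ≡⟨ encode-⊕p (toℕ i) (gap b) ⟩
      iterate next (encode (gap b)) (toℕ i) ≡⟨ cong (λ e → iterate next e (toℕ i)) (encode-decode (inj₂ b)) ⟩
      iterate next (inj₂ b) (toℕ i)         ∎
      where open ≡-Reasoning
    encode-⊕′ (inj₂ a) (inj₁ j) = begin
      encode (gap a ⊕ decode (inj₁ j))      ≡⟨ cong (λ y → encode (gap a ⊕ y)) (decode-inj₁ j) ⟩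
      encode (gap a ⊕ p (toℕ j))            ≡⟨ encode-⊕p (toℕ j) (gap a) ⟩
      iterate next (encode (gap a)) (toℕ j) ≡⟨ cong (λ e → iterate next e (toℕ j)) (encode-decode (inj₂ a)) ⟩
      iterate next (inj₂ a) (toℕ j)         ∎
      where open ≡-Reasoning
    encode-⊕′ (inj₂ a) (inj₂ b) = sym (begin
      locate (toℕ (Code.level code a) + toℕ (Code.level code b)) (Code.sum code a b)
        ≡⟨ cong₂ locate (cong₂ _+_ (toℕ-level a) (toℕ-level b)) (sum-≈ a b) ⟩
      locate (gapLevel a + gapLevel b) (describe _ (encode (gap a ⊕ gap b)))
        ≡⟨ locate-describe _ _ (sum-inWindow a b) ⟩
      encode (gap a ⊕ gap b)
        ∎)
      where open ≡-Reasoning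

    encode-⊕ : ∀ x y → encode (x ⊕ y) ≡ encode x ⊕ᴱ encode y
    encode-⊕ x y = trans (cong₂ (λ x y → encode (x ⊕ y)) (sym (decode-encode x)) (sym (decode-encode y)))
                         (encode-⊕′ (encode x) (encode y))

    key-strict′ : ∀ e e′ → decode e < decode e′ → key e Fin.< key e′
    key-strict′ (inj₁ i) (inj₁ j) lt = Finₚ.combine-monoˡ-< _ _
      (p-reflects-< (index≤L i) (index≤L j) (subst₂ _<_ (decode-inj₁ i) (decode-inj₁ j) lt))
    key-strict′ (inj₁ i) (inj₂ b) lt = combine-lex-< (subst (toℕ i ℕ.≤_) (sym (toℕ-level b))
      (gapLevel-maximal b (toℕ i) (index≤L i) (subst (_< gap b) (decode-inj₁ i) lt))) (λ _ → s≤s z≤n)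
    key-strict′ (inj₂ a) (inj₁ j) lt = Finₚ.combine-monoˡ-< _ _ (subst (ℕ._< toℕ j) (sym (toℕ-level a))
      (p-reflects-< (gapLevel≤L a) (index≤L j) (<-trans (p[gapLevel]<gap a) (subst (gap a <_) (decode-inj₁ j) lt))))
    key-strict′ (inj₂ a) (inj₂ b) lt = combine-lex-<
      (subst₂ ℕ._≤_ (sym (toℕ-level a)) (sym (toℕ-level b))
        (gapLevel-maximal b (gapLevel a) (gapLevel≤L a) (<-trans (p[gapLevel]<gap a) lt)))
      (λ _ → s≤s (subst₂ ℕ._<_ (rank-gap a) (rank-gap b) (rank-strict (gap-isGap a) lt)))

    key-strict : ∀ {x y} → x < y → key (encode x) Fin.< key (encode y)
    key-strict {x} {y} x<y =
      key-strict′ (encode x) (encode y) (subst₂ _<_ (sym (decode-encode x)) (sym (decode-encode y)) x<y)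

    encode-mono : ∀ {x y} → x ≤ y → encode x ≤ᴱ encode y
    encode-mono {x} {y} x≤y with x ≟ y
    ... | yes refl = Finₚ.≤-refl
    ... | no x≢y   = ℕₚ.<⇒≤ (key-strict (x≤y , x≢y))

    encode-reflect : ∀ {x y} → encode x ≤ᴱ encode y → x ≤ y
    encode-reflect {x} {y} ex≤ey with total x y | x ≟ y
    ... | inj₁ x≤y | _        = x≤y
    ... | inj₂ y≤x | yes refl = y≤x
    ... | inj₂ y≤x | no x≢y   = ⊥-elim (ℕₚ.<⇒≱ (key-strict (y≤x , x≢y ∘ sym)) ex≤ey)

    decode-mono : ∀ {e e′} → e ≤ᴱ e′ → decode e ≤ decode e′
    decode-mono {e} {e′} e≤e′ =
      encode-reflect (subst₂ _≤ᴱ_ (sym (encode-decode e)) (sym (encode-decode e′)) e≤e′)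

    axioms : Axioms
    axioms = record
      { ≤-⊕ᴱ         = λ r s → subst₂ _≤ᴱ_ (encode-decode r) (encode-⊕′ r s) (encode-mono (≤-⊕ (decode r) (decode s)))
      ; ⊕ᴱ-mono      = λ r s t u r≤t s≤u → subst₂ _≤ᴱ_ (encode-⊕′ r s) (encode-⊕′ t u)
                         (encode-mono (⊕-mono (decode-mono r≤t) (decode-mono s≤u)))
      ; ⊕ᴱ-comm      = λ r s → trans (sym (encode-⊕′ r s)) (trans (cong encode (⊕-comm _ _)) (encode-⊕′ s r))
      ; ⊕ᴱ-assoc     = assoc
      ; ⊕ᴱ-identityʳ = λ r → begin
          r ⊕ᴱ power 0              ≡⟨ cong₂ _⊕ᴱ_ (sym (encode-decode r)) (sym (encode-p 0)) ⟩
          encode (decode r) ⊕ᴱ encode 𝟘 ≡⟨ encode-⊕ (decode r) 𝟘 ⟨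
          encode (decode r ⊕ 𝟘)     ≡⟨ cong encode (⊕-identityʳ (decode r)) ⟩
          encode (decode r)         ≡⟨ encode-decode r ⟩
          r                         ∎
      }
      where
      open ≡-Reasoning
      assoc : ∀ r s t → (r ⊕ᴱ s) ⊕ᴱ t ≡ r ⊕ᴱ (s ⊕ᴱ t)
      assoc r s t = begin
        (r ⊕ᴱ s) ⊕ᴱ t                                       ≡⟨ cong₂ _⊕ᴱ_ (encode-⊕′ r s) (encode-decode t) ⟨
        encode (decode r ⊕ decode s) ⊕ᴱ encode (decode t)  ≡⟨ encode-⊕ _ _ ⟨
        encode ((decode r ⊕ decode s) ⊕ decode t)          ≡⟨ cong encode (⊕-assoc _ _ _) ⟩
        encode (decode r ⊕ (decode s ⊕ decode t))          ≡⟨ encode-⊕ _ _ ⟩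
        encode (decode r) ⊕ᴱ encode (decode s ⊕ decode t)  ≡⟨ cong₂ _⊕ᴱ_ (encode-decode r) (encode-⊕′ s t) ⟩
        r ⊕ᴱ (s ⊕ᴱ t)                                       ∎

    isomorphism : ∀ ax → M ≅ monoid ax
    isomorphism ax = record
      { to         = encode
      ; from       = decode
      ; from∘to    = decode-encode
      ; to∘from    = encode-decode
      ; to-⊕       = encode-⊕
      ; to-𝟘       = encode-p 0
      ; to-mono    = encode-mono
      ; to-reflect = encode-reflect
      }

Good : ℕ → ℕ → DistanceMonoid → Set
Good n L R = HasNonZeroCount R n × HasArch R L

module Candidate {n} (L k : ℕ) (size : suc L + k ≡ suc n) (code : Code L k) where
  open Model code

  hasArch? : ∀ ax → Dec (HasArch (monoid ax) L)
  hasArch? ax = FiniteDistanceMonoid.hasArch? (monoid ax) (elementEnumeration size) L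

  select : ∀ ax → Dec (HasArch (monoid ax) L) → Maybe DistanceMonoid
  select ax (yes _) = just (monoid ax)
  select ax (no _)  = nothing

  candidateFor : Dec Axioms → Maybe DistanceMonoid
  candidateFor (yes ax) = select ax (hasArch? ax)
  candidateFor (no _)   = nothing

  opaque
    candidate : Maybe DistanceMonoid
    candidate = candidateFor axioms?

    candidate-good : MaybeAll.All (Good n L) candidate
    candidate-good = forAxioms axioms?
      where
      forArch : ∀ ax arch? → MaybeAll.All (Good n L) (select ax arch?)
      forArch ax (yes arch) = MaybeAll.just (elementEnumeration size , arch)
      forArch ax (no _)     = MaybeAll.nothing
      forAxioms : ∀ ax? → MaybeAll.All (Good n L) (candidateFor ax?)
      forAxioms (yes ax) = forArch ax (hasArch? ax)
      forAxioms (no _)   = MaybeAll.nothing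

    candidate-complete : ∀ M → Axioms → (∀ ax → M ≅ monoid ax) → HasArch M L → MaybeAny.Any (M ≅_) candidate
    candidate-complete M ax₀ M≅monoid arch = forAxioms axioms?
      where
      forArch : ∀ ax arch? → MaybeAny.Any (M ≅_) (select ax arch?)
      forArch ax (yes _)    = MaybeAny.just (M≅monoid ax)
      forArch ax (no ¬arch) = ⊥-elim (¬arch (≅-hasArch (M≅monoid ax) arch))
      forAxioms : ∀ ax? → MaybeAny.Any (M ≅_) (candidateFor ax?)
      forAxioms (yes ax) = forArch ax (hasArch? ax)
      forAxioms (no ¬ax) = ⊥-elim (¬ax ax₀)

module _ {n} (L k : ℕ) (size : suc L + k ≡ suc n) where

  representatives : List DistanceMonoid
  representatives = mapMaybe (Candidate.candidate L k size ∘ decodeCode) (allFin (codeCount L k))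

  representatives-length : length representatives ℕ.≤ codeCount L k
  representatives-length = ℕₚ.≤-trans (Listₚ.length-mapMaybe _ (allFin (codeCount L k)))
                                      (ℕₚ.≤-reflexive (Listₚ.length-tabulate id))

  representatives-good : All (Good n L) representatives
  representatives-good =
    Allₚ.mapMaybe⁺ {f = Candidate.candidate L k size ∘ decodeCode}
      (Allₚ.map⁺ (All.universal (Candidate.candidate-good L k size ∘ decodeCode) (allFin (codeCount L k))))

representatives-complete : ∀ {n} L k (size : suc L + k ≡ suc n) → suc n ℕ.< L + L →
                           ∀ M → HasNonZeroCount M n → HasArch M L → Any (M ≅_) (representatives L k size)
representatives-complete zero     _ _ ()
representatives-complete {n} (suc L′) k size (s≤s 1+n<L+L) M enumeration arch =
  Anyₚ.mapMaybe⁺ (Candidate.candidate (suc L′) k size ∘ decodeCode) (allFin (codeCount (suc L′) k))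
    (Anyₚ.map⁺ (lose {P = λ c → MaybeAny.Any (M ≅_) (Candidate.candidate (suc L′) k size (decodeCode c))}
                     (∈-allFin (encodeCode canonical)) found))
  where
  open FiniteDistanceMonoid M enumeration using (powerChain)
  small : n ℕ.< suc L′ + L′
  small = subst (suc n ℕ.≤_) (ℕₚ.+-suc L′ L′) 1+n<L+L
  open NormalForm M enumeration size (powerChain arch small)
  canonical : Code (suc L′) k
  canonical = canonicalCode
  code : Code (suc L′) k
  code = decodeCode (encodeCode canonical)
  code≈canonical : code ≈ᶜ canonical
  code≈canonical = decode-encodeCode canonical
  found : MaybeAny.Any (M ≅_) (Candidate.candidate (suc L′) k size code)
  found = Candidate.candidate-complete (suc L′) k size code M
            (axioms code code≈canonical) (isomorphism code code≈canonical) arch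

^-distribʳ-* : ∀ a b m → (a * b) ^ m ≡ a ^ m * b ^ m
^-distribʳ-* a b zero    = refl
^-distribʳ-* a b (suc m) =
  trans (cong (a * b *_) (^-distribʳ-* a b m)) (ℕ-*.interchange a b (a ^ m) (b ^ m))
  where module ℕ-* = CommutativeSemigroupProperties ℕₚ.*-commutativeSemigroup

codeCount-bound : ∀ {n} k → 1 ℕ.≤ n → codeCount (n ∸ k) k ℕ.≤ 2 ^ k * tableCount k * n ^ k
codeCount-bound {n} k 1≤n = begin
  suc (n ∸ k) ^ k * tableCount k    ≤⟨ ℕₚ.*-monoˡ-≤ (tableCount k) (ℕₚ.^-monoˡ-≤ k 1+[n∸k]≤2n) ⟩
  (2 * n) ^ k * tableCount k        ≡⟨ cong (_* tableCount k) (^-distribʳ-* 2 n k) ⟩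
  2 ^ k * n ^ k * tableCount k      ≡⟨ ℕ-*.xy∙z≈xz∙y (2 ^ k) (n ^ k) (tableCount k) ⟩
  2 ^ k * tableCount k * n ^ k      ∎
  where
  open ℕₚ.≤-Reasoning
  module ℕ-* = CommutativeSemigroupProperties ℕₚ.*-commutativeSemigroup
  1+[n∸k]≤2n : suc (n ∸ k) ℕ.≤ 2 * n
  1+[n∸k]≤2n = begin
    suc (n ∸ k) ≤⟨ s≤s (ℕₚ.m∸n≤m n k) ⟩
    1 + n       ≤⟨ ℕₚ.+-monoˡ-≤ n 1≤n ⟩
    n + n       ≡⟨ cong (n +_) (ℕₚ.+-identityʳ n) ⟨
    2 * n       ∎

1+n<[n∸k]+[n∸k] : ∀ {n} k → suc (suc (k + k)) ℕ.≤ n → suc n ℕ.< (n ∸ k) + (n ∸ k)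
1+n<[n∸k]+[n∸k] {n} k N≤n = begin-strict
  suc n                  <⟨ ℕₚ.n<1+n _ ⟩
  2 + n                  ≡⟨ cong (2 +_) n∸k+k≡n ⟨
  2 + ((n ∸ k) + k)      ≡⟨ ℕ-+.x∙yz≈y∙xz (n ∸ k) 2 k ⟨
  (n ∸ k) + (2 + k)      ≤⟨ ℕₚ.+-monoʳ-≤ (n ∸ k) 2+k≤n∸k ⟩
  (n ∸ k) + (n ∸ k)      ∎
  where
  open ℕₚ.≤-Reasoning
  module ℕ-+ = CommutativeSemigroupProperties ℕₚ.+-commutativeSemigroup
  n∸k+k≡n : (n ∸ k) + k ≡ n
  n∸k+k≡n = ℕₚ.m∸n+n≡m (ℕₚ.≤-trans (ℕₚ.m≤n+m k (suc (suc k))) N≤n)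
  2+k≤n∸k : 2 + k ℕ.≤ n ∸ k
  2+k≤n∸k = ℕₚ.+-cancelʳ-≤ k (2 + k) (n ∸ k) (subst (suc (suc (k + k)) ℕ.≤_) (sym n∸k+k≡n) N≤n)

open import Data.Nat using (_≤_)

theorem1p2 : (k : ℕ) → Σ ℕ λ C → Σ ℕ λ N → (n : ℕ) → N ≤ n →
    Σ (List DistanceMonoid) λ L →
    (length L ≤ C * n ^ k)
    × All (λ M → HasNonZeroCount M n × HasArch M (n ∸ k)) L
    × ((M : DistanceMonoid) → HasNonZeroCount M n → HasArch M (n ∸ k) →
    Any (λ M′ → M ≅ M′) L)
theorem1p2 k = 2 ^ k * tableCount k , suc (suc (k + k)) , λ n N≤n →
    representatives (n ∸ k) k (size n N≤n)
  , ℕₚ.≤-trans (representatives-length (n ∸ k) k (size n N≤n)) (codeCount-bound k (ℕₚ.≤-trans (s≤s z≤n) N≤n))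
  , representatives-good (n ∸ k) k (size n N≤n)
  , representatives-complete (n ∸ k) k (size n N≤n) (1+n<[n∸k]+[n∸k] k N≤n)
  where
  size : ∀ n → suc (suc (k + k)) ≤ n → suc (n ∸ k) + k ≡ suc n
  size n N≤n = cong suc (ℕₚ.m∸n+n≡m (ℕₚ.≤-trans (ℕₚ.m≤n+m k (suc (suc k))) N≤n))
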